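{- For positive integers $n_1,\ldots,n_{d+1}$, $$F_{(n_1,\ldots,n_{d+1})} = \sum_{\alpha^{(1)}, \ldots, \alpha^{(d)}} m^{(n_{d+1})}_{\alpha^{(1)},\ldots,\alpha^{(d)}}\, M_{\alpha^{(1)}}(\mathbf{x}^{(1)}) \cdots M_{\alpha^{(d)}}(\mathbf{x}^{(d)}),$$ where the sum runs over compositions $\alpha^{(1)},\ldots,\alpha^{(d)}$ with $|\alpha^{(i)}|=|\alpha^{(j)}|$ for all $i,j$, and $m^{(n_{d+1})}_{\alpha^{(1)},\ldots,\alpha^{(d)}}$ is the number of packed matrices $A\in\mathcal{M}([n_1]\times\cdots\times[n_d],n_{d+1})$ with $s_\ell(A)=\alpha^{(\ell)}$ for all $\ell\in[d]$.
   Context: A $d$-dimensional partition is an array $\pi=(\pi_{\mathbf{i}})_{\mathbf{i}\in\mathbb{Z}_+^d}$ of nonnegative integers with finitely many nonzero entries, weakly decreasing in each coordinate; $D(\pi)=\{(\mathbf{i},i)\in\mathbb{Z}_+^{d+1}:1\le i\le\pi_{\mathbf{i}}\}$; $\mathcal{P}(n_1,\ldots,n_{d+1})$ is the set of those with $D(\pi)\subseteq[n_1]\times\cdots\times[n_{d+1}]$; $\mathrm{Cor}(\pi)=\{\mathbf{i}\in D(\pi):\mathbf{i}+\mathbf{e}_\ell\notin D(\pi)\ \forall\ell\in[d]\}$. With variables $\mathbf{x}^{(k)}=(x^{(k)}_1,\ldots,x^{(k)}_{n_k})$, $F_{(n_1,\ldots,n_{d+1})}=\sum_{\pi\in\mathcal{P}(n_1,\ldots,n_{d+1})}\prod_{(i_1,\ldots,i_{d+1})\in\mathrm{Cor}(\pi)}x^{(1)}_{i_1}\cdots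 x^{(d)}_{i_d}$. For an array $A=(a_{\mathbf{i}})$ of nonnegative integers indexed by $\mathbb{Z}_+^d$ with finitely many nonzero entries, let $G_{1,\ldots,1}(A)$ be the maximum of $\sum_{\mathbf{j}\in\Pi}a_{\mathbf{j}}$ over directed lattice paths $\Pi$ (steps $\mathbf{i}\to\mathbf{i}+\mathbf{e}_\ell$) starting at $(1,\ldots,1)$; $\mathcal{M}([n_1]\times\cdots\times[n_d],n_{d+1})$ is the set of such $A$ supported in $[n_1]\times\cdots\times[n_d]$ with $G_{1,\ldots,1}(A)\le n_{d+1}$. For $\ell\in[d]$ and $i\in[n_\ell]$, let $B^{(\ell)}_i$ be the sum of entries $a_{i_1,\ldots,i_d}$ with $i_\ell=i$, and $s_\ell(A)=(B^{(\ell)}_1,\ldots,B^{(\ell)}_{n_\ell})$; $A$ is packed if each $s_\ell(A)$ has no zero entries between positive entries; the equality $s_\ell(A)=\alpha^{(\ell)}$ is understood after deleting trailing zeros. For a composition $\alpha=(\alpha_1,\ldots,\alpha_k)\in\mathbb{Z}_+^k$, $M_\alpha(y_1,\ldots,y_n)=\sum_{i_1<\cdots<i_k}y_{i_1}^{\alpha_1}\cdots y_{i_k}^{\alpha_k}$ (zero if $k>n$), and $|\alpha|=\sum\alpha_i$. -}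

module Defs where

open import Data.Nat as ℕ using (ℕ; zero; suc; _⊔_; _<ᵇ_; _≤ᵇ_; _≡ᵇ_)
open import Data.Nat.Properties using (_<?_)
open import Data.Fin as Fin using (Fin; toℕ; fromℕ<)
open import Data.Fin.Properties using () renaming (_≟_ to _≟F_)
open import Data.List using (List; []; _∷_; map; concatMap; filter; filterᵇ; length; upTo; allFin; foldr; zipWith)
open import Data.Nat.ListAction using (sum)
open import Data.Bool.ListAction using (and)
open import Data.List.Properties using (≡-dec)
open import Data.Vec using (Vec; []; _∷_; lookup)
open import Data.Bool using (Bool; true; false; _∧_; not; if_then_else_)
open import Data.Product using (_×_; _,_)
open import Function using (_∘_)
open import Relation.Nullary using (yes; no; does)
open import Algebra.Bundles using (CommutativeSemiring)

-- Conventions: all indices are 0-based.  The paper's index i ∈ [n]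
-- (1 ≤ i ≤ n) corresponds to i-1 here; the paper's point (1,…,1) is
-- `origin`.  The dimension is d, the box sizes n₁,…,n_d are `n : Fin d → ℕ`
-- and n_{d+1} is the separate number `h`.

Point : ℕ → Set
Point d = Fin d → ℕ

origin : ∀ {d} → Point d
origin _ = 0

allᵇ : ∀ {A : Set} → (A → Bool) → List A → Bool
allᵇ p xs = and (map p xs)

bump : ∀ {d} → Point d → Fin d → Point d
bump p ℓ ℓ' = if does (ℓ' ≟F ℓ) then suc (p ℓ') else p ℓ'

Box : (d : ℕ) → (Fin d → ℕ) → Set
Box d n = (ℓ : Fin d) → Fin (n ℓ)

toPt : ∀ {d} {n : Fin d → ℕ} → Box d n → Point d
toPt b ℓ = toℕ (b ℓ)

consB : ∀ {d} {n : Fin (suc d) → ℕ} → Fin (n Fin.zero) → Box d (n ∘ Fin.suc) → Box (suc d) n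
consB i b Fin.zero = i
consB i b (Fin.suc ℓ) = b ℓ

allBox : (d : ℕ) (n : Fin d → ℕ) → List (Box d n)
allBox zero n = (λ ()) ∷ []
allBox (suc d) n = concatMap (λ i → map (consB i) (allBox d (n ∘ Fin.suc))) (allFin (n Fin.zero))

-- Arrays of nonnegative integers indexed by ℤ₊^d supported in the box
-- [n₁]×⋯×[n_d], stored as nested vectors; entries outside the box are 0.

Arr : (d : ℕ) → (Fin d → ℕ) → Set
Arr zero n = ℕ
Arr (suc d) n = Vec (Arr d (n ∘ Fin.suc)) (n Fin.zero)

entry : ∀ {d} {n : Fin d → ℕ} → Arr d n → Point d → ℕ
entry {zero} a p = a
entry {suc d} {n} A p with p Fin.zero <? n Fin.zero
... | yes lt = entry (lookup A (fromℕ< lt)) (p ∘ Fin.suc)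
... | no _ = 0

listsOver : ∀ {A : Set} (k : ℕ) → List A → List (List A)
listsOver zero xs = [] ∷ []
listsOver (suc k) xs = concatMap (λ x → map (x ∷_) (listsOver k xs)) xs

allVec : ∀ {A : Set} (k : ℕ) → List A → List (Vec A k)
allVec zero xs = [] ∷ []
allVec (suc k) xs = concatMap (λ x → map (x ∷_) (allVec k xs)) xs

allArr : (d : ℕ) (n : Fin d → ℕ) (c : ℕ) → List (Arr d n)
allArr zero n c = upTo (suc c)
allArr (suc d) n c = allVec (n Fin.zero) (allArr d (n ∘ Fin.suc) c)

-- d-dimensional partitions in 𝒫(n₁,…,n_d,h): arrays supported in the box
-- with entries ≤ h (enumerated by allArr d n h), weakly decreasing in each
-- coordinate direction.

isPartition : ∀ {d} {n : Fin d → ℕ} → Arr d n → Bool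
isPartition {d} {n} π =
  allᵇ (λ b → allᵇ (λ ℓ → entry π (bump (toPt b) ℓ) ≤ᵇ entry π (toPt b)) (allFin d)) (allBox d n)

corners : ∀ {d} {n : Fin d → ℕ} → Arr d n → List (Box d n × ℕ)
corners {d} {n} π =
  filterᵇ (λ { (b , k) → allᵇ (λ ℓ → entry π (bump (toPt b) ℓ) <ᵇ k) (allFin d) })
    (concatMap (λ b → map (λ k → (b , k)) (map suc (upTo (entry π (toPt b))))) (allBox d n))

-- Last passage value G_{1,…,1}(A): maximum of the weight over directed
-- lattice paths starting at (1,…,1).  A path is given by its list of steps.

weightFrom : ∀ {d} {n : Fin d → ℕ} → Arr d n → Point d → List (Fin d) → ℕ
weightFrom A p [] = entry A p
weightFrom A p (ℓ ∷ st) = entry A p ℕ.+ weightFrom A (bump p ℓ) st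

-- Paths with more than pathBound n steps leave the box, after which they
-- only collect zeros; so the maximum over all paths equals the maximum
-- over paths with at most pathBound n steps.
pathBound : ∀ {d} → (Fin d → ℕ) → ℕ
pathBound {d} n = sum (map n (allFin d))

G : ∀ {d} {n : Fin d → ℕ} → Arr d n → ℕ
G {d} {n} A =
  foldr _⊔_ 0 (map (weightFrom A origin) (concatMap (λ k → listsOver k (allFin d)) (upTo (suc (pathBound n)))))

Bsum : ∀ {d} {n : Fin d → ℕ} → Arr d n → Fin d → ℕ → ℕ
Bsum {d} {n} A ℓ i = sum (map (entry A ∘ toPt) (filter (λ b → toℕ (b ℓ) ℕ.≟ i) (allBox d n)))

sVec : ∀ {d} {n : Fin d → ℕ} → Arr d n → Fin d → List ℕ
sVec {n = n} A ℓ = map (Bsum A ℓ) (upTo (n ℓ))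

ix : List ℕ → ℕ → ℕ
ix [] _ = 0
ix (x ∷ xs) zero = x
ix (x ∷ xs) (suc i) = ix xs i

noGap : List ℕ → Bool
noGap v = allᵇ (λ i → allᵇ (λ j → allᵇ (λ k →
            not ((i <ᵇ j) ∧ (j <ᵇ k) ∧ (0 <ᵇ ix v i) ∧ (0 <ᵇ ix v k) ∧ (ix v j ≡ᵇ 0))) L) L) L
  where L = upTo (length v)

packed : ∀ {d} {n : Fin d → ℕ} → Arr d n → Bool
packed {d} A = allᵇ (λ ℓ → noGap (sVec A ℓ)) (allFin d)

cons0 : ℕ → List ℕ → List ℕ
cons0 zero [] = []
cons0 x ys = x ∷ ys

stripZeros : List ℕ → List ℕ
stripZeros [] = []
stripZeros (x ∷ xs) = cons0 x (stripZeros xs)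

sEq : List ℕ → List ℕ → Bool
sEq u v = does (≡-dec ℕ._≟_ u v)

-- m^{(h)}_{α^{(1)},…,α^{(d)}}: number of packed A ∈ 𝓜([n₁]×⋯×[n_d], h)
-- with s_ℓ(A) = α^{(ℓ)} for all ℓ.  (Every A with G(A) ≤ h has all entries
-- ≤ h, so enumerating arrays with entries in {0,…,h} loses nothing.)
mCount : (d : ℕ) (n : Fin d → ℕ) (h : ℕ) → (Fin d → List ℕ) → ℕ
mCount d n h α = length (filterᵇ
  (λ A → (G A ≤ᵇ h) ∧ packed A ∧ allᵇ (λ ℓ → sEq (stripZeros (sVec A ℓ)) (α ℓ)) (allFin d))
  (allArr d n h))

compositions : ℕ → List (List ℕ)
compositions N = filter (λ α → sum α ℕ.≟ N)
  (concatMap (λ k → listsOver k (map suc (upTo N))) (upTo (suc N)))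

consT : ∀ {d} → List ℕ → (Fin d → List ℕ) → (Fin (suc d) → List ℕ)
consT α t Fin.zero = α
consT α t (Fin.suc ℓ) = t ℓ

tuples : (d : ℕ) → List (List ℕ) → List (Fin d → List ℕ)
tuples zero cs = (λ ()) ∷ []
tuples (suc d) cs = concatMap (λ α → map (consT α) (tuples d cs)) cs

strictlyIncreasing : ∀ {m} → List (Fin m) → Bool
strictlyIncreasing [] = true
strictlyIncreasing (i ∷ []) = true
strictlyIncreasing (i ∷ j ∷ r) = (toℕ i <ᵇ toℕ j) ∧ strictlyIncreasing (j ∷ r)

-- Polynomial expressions, evaluated in an arbitrary commutative semiring.

module _ {a l} (R : CommutativeSemiring a l) where
  open CommutativeSemiring R renaming (Carrier to C)

  Σᴿ : List C → C
  Σᴿ = foldr _+_ 0#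

  Πᴿ : List C → C
  Πᴿ = foldr _*_ 1#

  pow : C → ℕ → C
  pow y zero = 1#
  pow y (suc k) = y * pow y k

  natMul : ℕ → C → C
  natMul zero y = 0#
  natMul (suc m) y = y + natMul m y

  Vars : (d : ℕ) → (Fin d → ℕ) → Set a
  Vars d n = (ℓ : Fin d) → Fin (n ℓ) → C

  Mα : List ℕ → ∀ {m} → (Fin m → C) → C
  Mα α {m} y = Σᴿ (map (λ is → Πᴿ (zipWith (λ i e → pow (y i) e) is α))
                       (filterᵇ strictlyIncreasing (listsOver (length α) (allFin m))))

  F : (d : ℕ) (n : Fin d → ℕ) (h : ℕ) → Vars d n → C
  F d n h x = Σᴿ (map (λ π → Πᴿ (map (λ { (b , k) → Πᴿ (map (λ ℓ → x ℓ (b ℓ)) (allFin d)) }) (corners π)))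
                      (filterᵇ isPartition (allArr d n h)))

  rhsTerm : (d : ℕ) (n : Fin d → ℕ) (h : ℕ) → Vars d n → ℕ → C
  rhsTerm d n h x N = Σᴿ (map (λ α → natMul (mCount d n h α) (Πᴿ (map (λ ℓ → Mα (α ℓ) (x ℓ)) (allFin d))))
                              (tuples d (compositions N)))

  rhsUpTo : (d : ℕ) (n : Fin d → ℕ) (h : ℕ) → Vars d n → ℕ → C
  rhsUpTo d n h x K = Σᴿ (map (rhsTerm d n h x) (upTo (suc K)))

-- Taking differences Δπ(p) = π(p) − max_ℓ π(p + e_ℓ) turns a partition π ∈ 𝒫(n₁,…,n_d,h) into an array A with
-- G(A) = π(1,…,1) ≤ h, and π is recovered from A as its last passage function p ↦ G_p(A). Since Δπ(p) counts the
-- corners of π over p, the corner monomial of π is ∏_ℓ ∏_i (x^{(ℓ)}_i)^{B^{(ℓ)}_i(A)}, so F is the sum of these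
-- monomials over all A with G(A) ≤ h. Deleting the zero slices of such an A leaves a packed array with the same last
-- passage value, and A is recovered from it and the increasing lists of positions of its nonzero slices. Summing the
-- monomial over these positions gives ∏_ℓ M_{s_ℓ(A)}(x^{(ℓ)}), and grouping the packed arrays by their slice sums gives
-- the right-hand side, in which sizes |α| beyond h·n₁⋯n_d contribute nothing.

module Submission where

open import Defs
open import Algebra.Bundles using (CommutativeMonoid; CommutativeSemiring)
open import Data.Bool using (Bool; true; false; T; T?; _∧_; not; if_then_else_)
import Data.Bool.Properties
open import Data.Empty using (⊥; ⊥-elim)
open import Data.Fin as Fin using (Fin; toℕ; fromℕ<)
open import Data.Fin.Properties
  using (toℕ<n; toℕ-injective; toℕ-fromℕ<; fromℕ<-toℕ; all?; ¬∀⟶∃¬) renaming (_≟_ to _≟F_)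
open import Data.List
  using (List; []; _∷_; map; _++_; concatMap; filterᵇ; filter; length; upTo; allFin; foldr; applyUpTo; zipWith; replicate)
open import Data.List.Properties
  using (≡-dec; ∷-injective; length-replicate; map-applyUpTo; map-tabulate; length-applyUpTo; length-map; map-cong;
         map-id; map-++; map-injective; applyUpTo-∷ʳ)
open import Data.Nat.ListAction using (sum; product)
open import Data.List.Membership.Propositional using (_∈_; _∉_)
open import Data.List.Membership.Propositional.Properties
  using (∈-∃++; ∈-++⁺ˡ; ∈-++⁺ʳ; ∈-++⁻; ∈-map⁺; ∈-map⁻; ∈-concatMap⁺; ∈-concatMap⁻; ∈-filter⁺; ∈-filter⁻;
         ∈-allFin; ∈-upTo⁺; ∈-upTo⁻)
open import Data.List.Relation.Unary.Any using (Any; here; there)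
open import Data.List.Relation.Unary.All as All using (All; []; _∷_)
open import Data.List.Relation.Unary.AllPairs using (AllPairs; []; _∷_)
import Data.List.Relation.Unary.AllPairs.Properties as AllPairs
open import Data.List.Relation.Unary.Unique.Propositional using (Unique)
import Data.List.Relation.Unary.Unique.Propositional.Properties as Unique
open import Data.Nat as ℕ using (ℕ; zero; suc; _+_; _*_; _∸_; _⊔_; _≤_; _<_; z≤n; s≤s; _<ᵇ_; _≤ᵇ_; _≡ᵇ_; pred)
open import Data.Nat.Properties as ℕ
  using (_<?_; ≤-refl; ≤-reflexive; ≤-trans; ≤-antisym; <-≤-trans; ≤-<-trans; <-trans; <-irrefl; <⇒≱;
         +-0-commutativeMonoid; ⊔-0-commutativeMonoid)
open import Data.List.Membership.DecPropositional ℕ._≟_ using () renaming (_∈?_ to _∈ℕ?_)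
open import Data.Product using (_×_; _,_; proj₁; proj₂; ∃-syntax)
open import Data.Product.Properties using (,-injectiveˡ; ,-injectiveʳ)
open import Data.Sum using (_⊎_; inj₁; inj₂)
open import Data.Unit using (⊤; tt)
open import Data.Vec as Vec using (Vec; []; _∷_; lookup)
import Data.Vec.Properties as Vec
open import Function using (_∘_; id)
open import Relation.Binary.PropositionalEquality
  using (_≡_; refl; _≢_; cong; cong₂; sym; trans; subst; subst₂; _≗_; module ≡-Reasoning)
open import Relation.Nullary using (¬_; Dec; yes; no; does)
import Relation.Nullary.Decidable as Dec
open import Relation.Binary.Definitions using (DecidableEquality)

T⇒≡true : ∀ {b} → T b → b ≡ true
T⇒≡true {true} _ = refl

≡true⇒T : ∀ {b} → b ≡ true → T b
≡true⇒T refl = tt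

≡false⇒¬T : ∀ {b} → b ≡ false → ¬ T b
≡false⇒¬T refl ()

Bool-ext : ∀ {a b : Bool} → (a ≡ true → b ≡ true) → (b ≡ true → a ≡ true) → a ≡ b
Bool-ext {true} {true} _ _ = refl
Bool-ext {true} {false} a⇒b _ with () ← a⇒b refl
Bool-ext {false} {true} _ b⇒a with () ← b⇒a refl
Bool-ext {false} {false} _ _ = refl

∧-true⁻ : ∀ {a b} → a ∧ b ≡ true → a ≡ true × b ≡ true
∧-true⁻ {true} {true} _ = refl , refl

∧-true⁺ : ∀ {a b} → a ≡ true → b ≡ true → a ∧ b ≡ true
∧-true⁺ refl refl = refl

<ᵇ-true⁺ : ∀ {m n} → m < n → (m <ᵇ n) ≡ true
<ᵇ-true⁺ m<n = T⇒≡true (ℕ.<⇒<ᵇ m<n)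

<ᵇ-true⁻ : ∀ {m n} → (m <ᵇ n) ≡ true → m < n
<ᵇ-true⁻ {m} {n} e = ℕ.<ᵇ⇒< m n (≡true⇒T e)

<ᵇ-false⁺ : ∀ {m n} → n ≤ m → (m <ᵇ n) ≡ false
<ᵇ-false⁺ {m} {n} n≤m with m <ᵇ n in eq
... | true = ⊥-elim (<⇒≱ (<ᵇ-true⁻ eq) n≤m)
... | false = refl

<ᵇ-false⁻ : ∀ {m n} → (m <ᵇ n) ≡ false → n ≤ m
<ᵇ-false⁻ e = ℕ.≮⇒≥ (≡false⇒¬T e ∘ ℕ.<⇒<ᵇ)

≤ᵇ-true⁺ : ∀ {m n} → m ≤ n → (m ≤ᵇ n) ≡ true
≤ᵇ-true⁺ m≤n = T⇒≡true (ℕ.≤⇒≤ᵇ m≤n)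

≤ᵇ-true⁻ : ∀ {m n} → (m ≤ᵇ n) ≡ true → m ≤ n
≤ᵇ-true⁻ {m} {n} e = ℕ.≤ᵇ⇒≤ m n (≡true⇒T e)

≡ᵇ-true⁺ : ∀ {m n} → m ≡ n → (m ≡ᵇ n) ≡ true
≡ᵇ-true⁺ {m} {n} m≡n = T⇒≡true (ℕ.≡⇒≡ᵇ m n m≡n)

≡ᵇ-true⁻ : ∀ {m n} → (m ≡ᵇ n) ≡ true → m ≡ n
≡ᵇ-true⁻ {m} {n} e = ℕ.≡ᵇ⇒≡ m n (≡true⇒T e)

≡ᵇ-false⁺ : ∀ {m n} → m ≢ n → (m ≡ᵇ n) ≡ false
≡ᵇ-false⁺ {m} {n} m≢n with m ≡ᵇ n in eq
... | true = ⊥-elim (m≢n (≡ᵇ-true⁻ eq))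
... | false = refl

module _ {a} {A : Set a} where

  All-++-remove : ∀ {p} {P : A → Set p} (xs : List A) {x ys} → All P (xs ++ x ∷ ys) → All P (xs ++ ys)
  All-++-remove [] (_ ∷ pys) = pys
  All-++-remove (_ ∷ xs) (px ∷ pxs) = px ∷ All-++-remove xs pxs

  Unique-++-remove : ∀ (xs : List A) {x ys} → Unique (xs ++ x ∷ ys) → Unique (xs ++ ys)
  Unique-++-remove [] (_ ∷ u) = u
  Unique-++-remove (_ ∷ xs) (y∉ ∷ u) = All-++-remove xs y∉ ∷ Unique-++-remove xs u

  Unique-++-∉ : ∀ (xs : List A) {x ys} → Unique (xs ++ x ∷ ys) → x ∉ xs ++ ys
  Unique-++-∉ [] (x∉ys ∷ _) x∈ys = All.lookup x∉ys x∈ys refl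
  Unique-++-∉ (y ∷ xs) (y∉ ∷ u) (here refl) = All.lookup y∉ (∈-++⁺ʳ xs (here refl)) refl
  Unique-++-∉ (y ∷ xs) (_ ∷ u) (there x∈) = Unique-++-∉ xs u x∈

  ∈-++-insert : ∀ (xs : List A) {x ys z} → z ∈ xs ++ ys → z ∈ xs ++ x ∷ ys
  ∈-++-insert xs z∈ with ∈-++⁻ xs z∈
  ... | inj₁ z∈xs = ∈-++⁺ˡ z∈xs
  ... | inj₂ z∈ys = ∈-++⁺ʳ xs (there z∈ys)

  Unique-map : ∀ {b} {B : Set b} (f : A → B) {xs} → Unique xs →
    (∀ {x y} → x ∈ xs → y ∈ xs → f x ≡ f y → x ≡ y) → Unique (map f xs)
  Unique-map f {[]} [] inj = []
  Unique-map f {x ∷ xs} (x∉ ∷ u) inj = fx∉ x∉ id ∷ Unique-map f u (λ x∈ y∈ → inj (there x∈) (there y∈))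
    where
    fx∉ : ∀ {ys} → All (x ≢_) ys → (∀ {y} → y ∈ ys → y ∈ xs) → All (f x ≢_) (map f ys)
    fx∉ [] _ = []
    fx∉ (x≢y ∷ x∉ys) ys⊆xs = (x≢y ∘ inj (here refl) (there (ys⊆xs (here refl)))) ∷ fx∉ x∉ys (ys⊆xs ∘ there)

  Unique-concatMap : ∀ {b} {B : Set b} (g : A → List B) {xs} → Unique xs →
    (∀ x → Unique (g x)) → (∀ {x y z} → z ∈ g x → z ∈ g y → x ≡ y) → Unique (concatMap g xs)
  Unique-concatMap g {[]} [] ug disjoint = []
  Unique-concatMap g {x ∷ xs} (x∉ ∷ u) ug disjoint =
    Unique.++⁺ (ug x) (Unique-concatMap g u ug disjoint) (λ (z∈gx , z∈rest) → ∉-rest x∉ z∈gx z∈rest)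
    where
    ∉-rest : ∀ {ys} → All (x ≢_) ys → ∀ {z} → z ∈ g x → z ∉ concatMap g ys
    ∉-rest {y ∷ ys} (x≢y ∷ x∉ys) z∈gx z∈ with ∈-++⁻ (g y) z∈
    ... | inj₁ z∈gy = x≢y (disjoint z∈gx z∈gy)
    ... | inj₂ z∈rest = ∉-rest x∉ys z∈gx z∈rest

  ∈-filterᵇ⁺ : ∀ (p : A → Bool) {x xs} → x ∈ xs → p x ≡ true → x ∈ filterᵇ p xs
  ∈-filterᵇ⁺ p x∈ px = ∈-filter⁺ (T? ∘ p) x∈ (≡true⇒T px)

  ∈-filterᵇ⁻ : ∀ (p : A → Bool) {x xs} → x ∈ filterᵇ p xs → x ∈ xs × p x ≡ true
  ∈-filterᵇ⁻ p x∈ = let x∈xs , px = ∈-filter⁻ (T? ∘ p) x∈ in x∈xs , T⇒≡true px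

  Unique-filterᵇ : ∀ (p : A → Bool) {xs} → Unique xs → Unique (filterᵇ p xs)
  Unique-filterᵇ p = Unique.filter⁺ (T? ∘ p)

allᵇ⁺ : ∀ {A : Set} (p : A → Bool) xs → (∀ {x} → x ∈ xs → p x ≡ true) → allᵇ p xs ≡ true
allᵇ⁺ p [] _ = refl
allᵇ⁺ p (x ∷ xs) all-p rewrite all-p (here refl) = allᵇ⁺ p xs (all-p ∘ there)

allᵇ⁻ : ∀ {A : Set} (p : A → Bool) xs → allᵇ p xs ≡ true → ∀ {x} → x ∈ xs → p x ≡ true
allᵇ⁻ p (y ∷ xs) e x∈ with p y in py
allᵇ⁻ p (y ∷ xs) e (here refl) | true = py
allᵇ⁻ p (y ∷ xs) e (there x∈) | true = allᵇ⁻ p xs e x∈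

module _ {A : Set} (as : List A) where

  ∈-listsOver⁺ : ∀ (xs : List A) → All (_∈ as) xs → xs ∈ listsOver (length xs) as
  ∈-listsOver⁺ [] [] = here refl
  ∈-listsOver⁺ (x ∷ xs) (x∈ ∷ xs⊆) = ∈-concatMap⁺ (λ y → map (y ∷_) (listsOver (length xs) as)) (go x∈)
    where
    go : ∀ {as′} → x ∈ as′ → Any (λ y → (x ∷ xs) ∈ map (y ∷_) (listsOver (length xs) as)) as′
    go (here refl) = here (∈-map⁺ (x ∷_) (∈-listsOver⁺ xs xs⊆))
    go (there x∈) = there (go x∈)

  ∈-listsOver⁻ : ∀ k (xs : List A) → xs ∈ listsOver k as → length xs ≡ k × All (_∈ as) xs
  ∈-listsOver⁻ zero xs (here refl) = refl , []
  ∈-listsOver⁻ (suc k) xs xs∈ = go as id (∈-concatMap⁻ (λ y → map (y ∷_) (listsOver k as)) {xs = as} xs∈)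
    where
    go : ∀ as′ → (∀ {y} → y ∈ as′ → y ∈ as) → Any (λ y → xs ∈ map (y ∷_) (listsOver k as)) as′ →
         length xs ≡ suc k × All (_∈ as) xs
    go (y ∷ as′) ⊆as (here xs∈′) with ∈-map⁻ (y ∷_) xs∈′
    ... | ys , ys∈ , refl = let len , ys⊆ = ∈-listsOver⁻ k ys ys∈ in cong suc len , ⊆as (here refl) ∷ ys⊆
    go (y ∷ as′) ⊆as (there xs∈′) = go as′ (⊆as ∘ there) xs∈′

  Unique-listsOver : ∀ k → Unique as → Unique (listsOver k as)
  Unique-listsOver zero u = [] ∷ []
  Unique-listsOver (suc k) u = Unique-concatMap (λ y → map (y ∷_) (listsOver k as)) u
    (λ y → Unique-map (y ∷_) (Unique-listsOver k u) (λ _ _ → proj₂ ∘ ∷-injective))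
    disjoint
    where
    disjoint : ∀ {x y z} → z ∈ map (x ∷_) (listsOver k as) → z ∈ map (y ∷_) (listsOver k as) → x ≡ y
    disjoint z∈ z∈′ with ∈-map⁻ _ z∈ | ∈-map⁻ _ z∈′
    ... | _ , _ , refl | _ , _ , e = proj₁ (∷-injective e)

  ∈-allVec⁺ : ∀ k (v : Vec A k) → (∀ i → lookup v i ∈ as) → v ∈ allVec k as
  ∈-allVec⁺ zero [] _ = here refl
  ∈-allVec⁺ (suc k) (x ∷ v) v⊆ = ∈-concatMap⁺ (λ y → map (y ∷_) (allVec k as)) (go (v⊆ Fin.zero))
    where
    go : ∀ {as′} → x ∈ as′ → Any (λ y → (x ∷ v) ∈ map (y ∷_) (allVec k as)) as′
    go (here refl) = here (∈-map⁺ (x ∷_) (∈-allVec⁺ k v (v⊆ ∘ Fin.suc)))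
    go (there x∈) = there (go x∈)

  ∈-allVec⁻ : ∀ k (v : Vec A k) → v ∈ allVec k as → ∀ i → lookup v i ∈ as
  ∈-allVec⁻ (suc k) (x ∷ v) v∈ = go as id (∈-concatMap⁻ (λ y → map (y ∷_) (allVec k as)) {xs = as} v∈)
    where
    go : ∀ as′ → (∀ {y} → y ∈ as′ → y ∈ as) → Any (λ y → (x ∷ v) ∈ map (y ∷_) (allVec k as)) as′ →
         ∀ i → lookup (x ∷ v) i ∈ as
    go (y ∷ as′) ⊆as (here v∈′) i with ∈-map⁻ (y ∷_) v∈′
    go (y ∷ as′) ⊆as (here v∈′) Fin.zero | _ , _ , refl = ⊆as (here refl)
    go (y ∷ as′) ⊆as (here v∈′) (Fin.suc i) | w , w∈ , refl = ∈-allVec⁻ k w w∈ i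
    go (y ∷ as′) ⊆as (there v∈′) i = go as′ (⊆as ∘ there) v∈′ i

  Unique-allVec : ∀ k → Unique as → Unique (allVec k as)
  Unique-allVec zero u = [] ∷ []
  Unique-allVec (suc k) u = Unique-concatMap (λ y → map (y ∷_) (allVec k as)) u
    (λ y → Unique-map (y ∷_) (Unique-allVec k u) (λ _ _ → proj₂ ∘ Vec.∷-injective))
    disjoint
    where
    disjoint : ∀ {x y z} → z ∈ map (x ∷_) (allVec k as) → z ∈ map (y ∷_) (allVec k as) → x ≡ y
    disjoint z∈ z∈′ with ∈-map⁻ _ z∈ | ∈-map⁻ _ z∈′
    ... | _ , _ , refl | _ , _ , e = proj₁ (Vec.∷-injective e)

module ListFold {c ℓ} (M : CommutativeMonoid c ℓ) where
  open CommutativeMonoid M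
    renaming (Carrier to C; refl to ≈-refl; sym to ≈-sym; trans to ≈-trans; reflexive to ≈-reflexive)
  open import Relation.Binary.Reasoning.Setoid setoid

  fold : List C → C
  fold = foldr _∙_ ε

  module _ {b} {B : Set b} where

    fold-map-cong : ∀ (f g : B → C) xs → (∀ x → f x ≈ g x) → fold (map f xs) ≈ fold (map g xs)
    fold-map-cong f g [] e = ≈-refl
    fold-map-cong f g (x ∷ xs) e = ∙-cong (e x) (fold-map-cong f g xs e)

    fold-map-cong-∈ : ∀ (f g : B → C) xs → (∀ {x} → x ∈ xs → f x ≈ g x) → fold (map f xs) ≈ fold (map g xs)
    fold-map-cong-∈ f g [] e = ≈-refl
    fold-map-cong-∈ f g (x ∷ xs) e = ∙-cong (e (here refl)) (fold-map-cong-∈ f g xs (e ∘ there))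

    fold-map-∙ : ∀ (f g : B → C) xs → fold (map (λ x → f x ∙ g x) xs) ≈ fold (map f xs) ∙ fold (map g xs)
    fold-map-∙ f g [] = ≈-sym (identityˡ _)
    fold-map-∙ f g (x ∷ xs) = begin
      (f x ∙ g x) ∙ fold (map (λ x → f x ∙ g x) xs)     ≈⟨ ∙-congˡ (fold-map-∙ f g xs) ⟩
      (f x ∙ g x) ∙ (fold (map f xs) ∙ fold (map g xs)) ≈⟨ assoc _ _ _ ⟩
      f x ∙ (g x ∙ (fold (map f xs) ∙ fold (map g xs))) ≈⟨ ∙-congˡ (≈-sym (assoc _ _ _)) ⟩
      f x ∙ ((g x ∙ fold (map f xs)) ∙ fold (map g xs)) ≈⟨ ∙-congˡ (∙-congʳ (comm _ _)) ⟩
      f x ∙ ((fold (map f xs) ∙ g x) ∙ fold (map g xs)) ≈⟨ ∙-congˡ (assoc _ _ _) ⟩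
      f x ∙ (fold (map f xs) ∙ (g x ∙ fold (map g xs))) ≈⟨ ≈-sym (assoc _ _ _) ⟩
      (f x ∙ fold (map f xs)) ∙ (g x ∙ fold (map g xs)) ∎

    fold-map-ε : ∀ (f : B → C) xs → (∀ x → f x ≈ ε) → fold (map f xs) ≈ ε
    fold-map-ε f [] e = ≈-refl
    fold-map-ε f (x ∷ xs) e = ≈-trans (∙-cong (e x) (fold-map-ε f xs e)) (identityˡ _)

    fold-map-ε-∈ : ∀ (f : B → C) xs → (∀ {x} → x ∈ xs → f x ≈ ε) → fold (map f xs) ≈ ε
    fold-map-ε-∈ f [] e = ≈-refl
    fold-map-ε-∈ f (x ∷ xs) e = ≈-trans (∙-cong (e (here refl)) (fold-map-ε-∈ f xs (e ∘ there))) (identityˡ _)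

    fold-map-++ : ∀ (f : B → C) xs ys → fold (map f (xs ++ ys)) ≈ fold (map f xs) ∙ fold (map f ys)
    fold-map-++ f [] ys = ≈-sym (identityˡ _)
    fold-map-++ f (x ∷ xs) ys = ≈-trans (∙-congˡ (fold-map-++ f xs ys)) (≈-sym (assoc _ _ _))

    fold-map-filterᵇ : ∀ (p : B → Bool) (f : B → C) xs →
      fold (map f (filterᵇ p xs)) ≈ fold (map (λ x → if p x then f x else ε) xs)
    fold-map-filterᵇ p f [] = ≈-refl
    fold-map-filterᵇ p f (x ∷ xs) with p x
    ... | true = ∙-congˡ (fold-map-filterᵇ p f xs)
    ... | false = ≈-trans (fold-map-filterᵇ p f xs) (≈-sym (identityˡ _))

    fold-map-filterᵇ-ε : ∀ (p : B → Bool) (f : B → C) xs → (∀ {x} → x ∈ xs → p x ≡ false → f x ≈ ε) →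
      fold (map f xs) ≈ fold (map f (filterᵇ p xs))
    fold-map-filterᵇ-ε p f [] e = ≈-refl
    fold-map-filterᵇ-ε p f (x ∷ xs) e with p x in eq
    ... | true = ∙-congˡ (fold-map-filterᵇ-ε p f xs (e ∘ there))
    ... | false = ≈-trans (∙-congʳ (e (here refl) eq))
                    (≈-trans (identityˡ _) (fold-map-filterᵇ-ε p f xs (e ∘ there)))

    fold-map-set-equal : ∀ (f : B → C) (xs ys : List B) → Unique xs → Unique ys →
      (∀ {z} → z ∈ xs → z ∈ ys) → (∀ {z} → z ∈ ys → z ∈ xs) →
      fold (map f xs) ≈ fold (map f ys)
    fold-map-set-equal f [] [] ux uy xs⊆ys ys⊆xs = ≈-refl
    fold-map-set-equal f [] (y ∷ ys) ux uy xs⊆ys ys⊆xs with () ← ys⊆xs (here refl)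
    fold-map-set-equal f (x ∷ xs) ys (x∉xs ∷ ux) uy xs⊆ys ys⊆xs with ∈-∃++ (xs⊆ys (here refl))
    ... | ys₁ , ys₂ , refl = begin
        f x ∙ fold (map f xs)
          ≈⟨ ∙-congˡ (fold-map-set-equal f xs (ys₁ ++ ys₂) ux (Unique-++-remove ys₁ uy) ⊆-rest ⊇-rest) ⟩
        f x ∙ fold (map f (ys₁ ++ ys₂))                 ≈⟨ ∙-congˡ (fold-map-++ f ys₁ ys₂) ⟩
        f x ∙ (fold (map f ys₁) ∙ fold (map f ys₂))     ≈⟨ ≈-sym (assoc _ _ _) ⟩
        (f x ∙ fold (map f ys₁)) ∙ fold (map f ys₂)     ≈⟨ ∙-congʳ (comm _ _) ⟩
        (fold (map f ys₁) ∙ f x) ∙ fold (map f ys₂)     ≈⟨ assoc _ _ _ ⟩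
        fold (map f ys₁) ∙ (f x ∙ fold (map f ys₂))     ≈⟨ ≈-sym (fold-map-++ f ys₁ (x ∷ ys₂)) ⟩
        fold (map f (ys₁ ++ x ∷ ys₂))                   ∎
      where
      ⊆-rest : ∀ {z} → z ∈ xs → z ∈ ys₁ ++ ys₂
      ⊆-rest {z} z∈xs with ∈-++⁻ ys₁ (xs⊆ys (there z∈xs))
      ... | inj₁ z∈ys₁ = ∈-++⁺ˡ z∈ys₁
      ... | inj₂ (here refl) = ⊥-elim (All.lookup x∉xs z∈xs refl)
      ... | inj₂ (there z∈ys₂) = ∈-++⁺ʳ ys₁ z∈ys₂
      ⊇-rest : ∀ {z} → z ∈ ys₁ ++ ys₂ → z ∈ xs
      ⊇-rest z∈ys with ys⊆xs (∈-++-insert ys₁ z∈ys)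
      ... | here refl = ⊥-elim (Unique-++-∉ ys₁ uy z∈ys)
      ... | there z∈xs = z∈xs

    fold-map-single : ∀ (f : B → C) (xs : List B) (z : B) → Unique xs → z ∈ xs →
      (∀ {y} → y ∈ xs → y ≢ z → f y ≈ ε) → fold (map f xs) ≈ f z
    fold-map-single f (x ∷ xs) z (x∉xs ∷ u) (here refl) off =
      ≈-trans (∙-congˡ (fold-map-ε-∈ f xs (λ y∈xs → off (there y∈xs) (All.lookup x∉xs y∈xs ∘ sym))))
              (identityʳ _)
    fold-map-single f (x ∷ xs) z (x∉xs ∷ u) (there z∈xs) off =
      ≈-trans (∙-congʳ (off (here refl) (All.lookup x∉xs z∈xs)))
              (≈-trans (identityˡ _) (fold-map-single f xs z u z∈xs (off ∘ there)))

    fold-map-support : DecidableEquality B → ∀ (f : B → C) (xs ys : List B) → Unique xs → Unique ys →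
      (∀ {y} → y ∈ ys → y ∈ xs) → (∀ {x} → x ∈ xs → x ∉ ys → f x ≈ ε) →
      fold (map f xs) ≈ fold (map f ys)
    fold-map-support _≟_ f xs ys u-xs u-ys ys⊆xs off =
      ≈-trans (fold-map-filterᵇ-ε ∈ys f xs (λ x∈xs e → off x∈xs (λ x∈ys → ≡false⇒¬T e (∈ys-true x∈ys))))
        (fold-map-set-equal f (filterᵇ ∈ys xs) ys (Unique-filterᵇ ∈ys u-xs) u-ys
          (λ {x} x∈ → Dec.toWitness {a? = x ∈? ys} (≡true⇒T (proj₂ (∈-filterᵇ⁻ ∈ys {xs = xs} x∈))))
          (λ y∈ → ∈-filterᵇ⁺ ∈ys (ys⊆xs y∈) (T⇒≡true (∈ys-true y∈))))
      where
      open import Data.List.Membership.DecPropositional _≟_ using (_∈?_)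
      ∈ys : B → Bool
      ∈ys x = Dec.isYes (x ∈? ys)
      ∈ys-true : ∀ {x} → x ∈ ys → T (∈ys x)
      ∈ys-true {x} = Dec.fromWitness {a? = x ∈? ys}

  module _ {b b′} {B : Set b} {B′ : Set b′} where

    fold-map-map : ∀ (f : B′ → C) (g : B → B′) xs → fold (map f (map g xs)) ≈ fold (map (f ∘ g) xs)
    fold-map-map f g [] = ≈-refl
    fold-map-map f g (x ∷ xs) = ∙-congˡ (fold-map-map f g xs)

    fold-map-concatMap : ∀ (f : B′ → C) (g : B → List B′) xs →
      fold (map f (concatMap g xs)) ≈ fold (map (λ x → fold (map f (g x))) xs)
    fold-map-concatMap f g [] = ≈-refl
    fold-map-concatMap f g (x ∷ xs) =
      ≈-trans (fold-map-++ f (g x) (concatMap g xs)) (∙-congˡ (fold-map-concatMap f g xs))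

    fold-map-swap : ∀ (f : B → B′ → C) xs ys →
      fold (map (λ x → fold (map (f x) ys)) xs) ≈ fold (map (λ y → fold (map (λ x → f x y) xs)) ys)
    fold-map-swap f [] ys = ≈-sym (fold-map-ε (λ _ → ε) ys (λ _ → ≈-refl))
    fold-map-swap f (x ∷ xs) ys =
      ≈-trans (∙-congˡ (fold-map-swap f xs ys)) (≈-sym (fold-map-∙ (f x) (λ y → fold (map (λ x → f x y) xs)) ys))

  fold-map-bijection : ∀ {I B : Set} (f : I → B) (g : B → I) (is : List I) (bs : List B) →
    Unique is → Unique bs →
    (∀ {i} → i ∈ is → f i ∈ bs) → (∀ {i} → i ∈ is → g (f i) ≡ i) →
    (∀ {b} → b ∈ bs → g b ∈ is) → (∀ {b} → b ∈ bs → f (g b) ≡ b) →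
    (w : B → C) → fold (map (w ∘ f) is) ≈ fold (map w bs)
  fold-map-bijection f g is bs u-is u-bs f∈ gf g∈ fg w =
    ≈-trans (≈-sym (fold-map-map w f is))
      (fold-map-set-equal w (map f is) bs u-fis u-bs
        (λ z∈ → let i , i∈ , z≡fi = ∈-map⁻ f z∈ in subst (_∈ bs) (sym z≡fi) (f∈ i∈))
        (λ b∈ → subst (_∈ map f is) (fg b∈) (∈-map⁺ f (g∈ b∈))))
    where
    u-fis : Unique (map f is)
    u-fis = Unique-map f u-is (λ i∈ j∈ fi≡fj → trans (sym (gf i∈)) (trans (cong g fi≡fj) (gf j∈)))

consP : ∀ {d} → ℕ → Point d → Point (suc d)
consP i q Fin.zero = i
consP i q (Fin.suc ℓ) = q ℓ

-- Points are functions, so without function extensionality every function of points must be shown to respect ≗.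
Respects≗ : ∀ {d} → (Point d → ℕ) → Set
Respects≗ {d} f = ∀ {p q : Point d} → p ≗ q → f p ≡ f q

consP-cong : ∀ {d} {i j : ℕ} {p q : Point d} → i ≡ j → p ≗ q → consP i p ≗ consP j q
consP-cong i≡j _ Fin.zero = i≡j
consP-cong _ p≗q (Fin.suc ℓ) = p≗q ℓ

consP-η : ∀ {d} (p : Point (suc d)) → consP (p Fin.zero) (p ∘ Fin.suc) ≗ p
consP-η p Fin.zero = refl
consP-η p (Fin.suc ℓ) = refl

InBox : ∀ {d} → (Fin d → ℕ) → Point d → Set
InBox n p = ∀ ℓ → p ℓ < n ℓ

inBox? : ∀ {d} (n : Fin d → ℕ) (p : Point d) → Dec (InBox n p)
inBox? n p = all? (λ ℓ → p ℓ <? n ℓ)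

¬InBox⇒outside : ∀ {d} (n : Fin d → ℕ) (p : Point d) → ¬ InBox n p → ∃[ ℓ ] n ℓ ≤ p ℓ
¬InBox⇒outside {d} n p p∉ with ¬∀⟶∃¬ d (λ ℓ → p ℓ < n ℓ) (λ ℓ → p ℓ <? n ℓ) p∉
... | ℓ , p≮n = ℓ , ℕ.≮⇒≥ p≮n

entry-resp-≗ : ∀ {d} {n : Fin d → ℕ} (A : Arr d n) → Respects≗ (entry A)
entry-resp-≗ {zero} A _ = refl
entry-resp-≗ {suc d} {n} A {p} {q} p≗q with p Fin.zero <? n Fin.zero | q Fin.zero <? n Fin.zero
... | yes p₀< | yes q₀< =
  trans (cong (λ j → entry (lookup A j) (p ∘ Fin.suc))
              (toℕ-injective (trans (toℕ-fromℕ< p₀<) (trans (p≗q Fin.zero) (sym (toℕ-fromℕ< q₀<))))))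
        (entry-resp-≗ (lookup A (fromℕ< q₀<)) (p≗q ∘ Fin.suc))
... | yes p₀< | no q₀≮ = ⊥-elim (q₀≮ (subst (_< n Fin.zero) (p≗q Fin.zero) p₀<))
... | no p₀≮ | yes q₀< = ⊥-elim (p₀≮ (subst (_< n Fin.zero) (sym (p≗q Fin.zero)) q₀<))
... | no _ | no _ = refl

entry-consP : ∀ {d} {n : Fin (suc d) → ℕ} (A : Arr (suc d) n) (i : Fin (n Fin.zero)) (q : Point d) →
  entry {n = n} A (consP (toℕ i) q) ≡ entry {n = n ∘ Fin.suc} (lookup A i) q
entry-consP {n = n} A i q with toℕ i <? n Fin.zero
... | yes i< = cong (λ j → entry (lookup A j) q) (fromℕ<-toℕ i i<)
... | no i≮ = ⊥-elim (i≮ (toℕ<n i))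

entry-outside : ∀ {d} {n : Fin d → ℕ} (A : Arr d n) (p : Point d) ℓ → n ℓ ≤ p ℓ → entry A p ≡ 0
entry-outside {suc d} {n} A p Fin.zero n≤p with p Fin.zero <? n Fin.zero
... | yes p< = ⊥-elim (<⇒≱ p< n≤p)
... | no _ = refl
entry-outside {suc d} {n} A p (Fin.suc ℓ) n≤p with p Fin.zero <? n Fin.zero
... | yes p< = entry-outside (lookup A (fromℕ< p<)) (p ∘ Fin.suc) ℓ n≤p
... | no _ = refl

entry-¬InBox : ∀ {d} {n : Fin d → ℕ} (A : Arr d n) (p : Point d) → ¬ InBox n p → entry A p ≡ 0
entry-¬InBox {n = n} A p p∉ = let ℓ , n≤p = ¬InBox⇒outside n p p∉ in entry-outside A p ℓ n≤p

tabulateArr : ∀ {d} {n : Fin d → ℕ} → (Point d → ℕ) → Arr d n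
tabulateArr {zero} f = f (λ ())
tabulateArr {suc d} f = Vec.tabulate (λ i → tabulateArr (f ∘ consP (toℕ i)))

entry-tabulateArr : ∀ {d} {n : Fin d → ℕ} (f : Point d → ℕ) → Respects≗ f →
  ∀ p → InBox n p → entry {n = n} (tabulateArr f) p ≡ f p
entry-tabulateArr {zero} f f-resp p _ = f-resp (λ ())
entry-tabulateArr {suc d} {n} f f-resp p p∈ with p Fin.zero <? n Fin.zero
... | yes p₀< =
  trans (cong (λ a → entry {n = n ∘ Fin.suc} a (p ∘ Fin.suc)) (Vec.lookup∘tabulate _ (fromℕ< p₀<)))
    (trans (entry-tabulateArr (f ∘ consP (toℕ (fromℕ< p₀<))) (f-resp ∘ consP-cong refl) (p ∘ Fin.suc) (p∈ ∘ Fin.suc))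
           (f-resp (λ { Fin.zero → toℕ-fromℕ< p₀< ; (Fin.suc ℓ) → refl })))
... | no p₀≮ = ⊥-elim (p₀≮ (p∈ Fin.zero))

entry-tabulateArr′ : ∀ {d} {n : Fin d → ℕ} (f : Point d → ℕ) → Respects≗ f →
  (∀ p → ¬ InBox n p → f p ≡ 0) → ∀ p → entry {n = n} (tabulateArr f) p ≡ f p
entry-tabulateArr′ {n = n} f f-resp f-out p with inBox? n p
... | yes p∈ = entry-tabulateArr f f-resp p p∈
... | no p∉ = trans (entry-¬InBox (tabulateArr f) p p∉) (sym (f-out p p∉))

Arr-ext : ∀ {d} {n : Fin d → ℕ} (A B : Arr d n) → (∀ p → InBox n p → entry A p ≡ entry B p) → A ≡ B
Arr-ext {zero} A B A≐B = A≐B (λ ()) (λ ())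
Arr-ext {suc d} {n} A B A≐B =
  trans (sym (Vec.tabulate∘lookup A)) (trans (Vec.tabulate-cong rows≡) (Vec.tabulate∘lookup B))
  where
  rows≡ : ∀ i → lookup A i ≡ lookup B i
  rows≡ i = Arr-ext {n = n ∘ Fin.suc} (lookup A i) (lookup B i) (λ q q∈ →
    trans (sym (entry-consP {n = n} A i q))
      (trans (A≐B (consP (toℕ i) q) (λ { Fin.zero → toℕ<n i ; (Fin.suc ℓ) → q∈ ℓ })) (entry-consP {n = n} B i q)))

∈-allArr⁺ : ∀ {d} {n : Fin d → ℕ} (c : ℕ) (A : Arr d n) → (∀ p → entry A p ≤ c) → A ∈ allArr d n c
∈-allArr⁺ {zero} c A A≤c = ∈-upTo⁺ (s≤s (A≤c (λ ())))
∈-allArr⁺ {suc d} {n} c A A≤c = ∈-allVec⁺ _ _ A (λ i → ∈-allArr⁺ {n = n ∘ Fin.suc} c (lookup A i)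
  (λ q → subst (_≤ c) (entry-consP {n = n} A i q) (A≤c (consP (toℕ i) q))))

∈-allArr⁻ : ∀ {d} {n : Fin d → ℕ} (c : ℕ) (A : Arr d n) → A ∈ allArr d n c → ∀ p → entry A p ≤ c
∈-allArr⁻ {zero} c A A∈ p = ℕ.≤-pred (∈-upTo⁻ A∈)
∈-allArr⁻ {suc d} {n} c A A∈ p with p Fin.zero <? n Fin.zero
... | yes p₀< = ∈-allArr⁻ {n = n ∘ Fin.suc} c (lookup A (fromℕ< p₀<)) (∈-allVec⁻ _ _ A A∈ (fromℕ< p₀<)) (p ∘ Fin.suc)
... | no _ = z≤n

Unique-allArr : ∀ d (n : Fin d → ℕ) c → Unique (allArr d n c)
Unique-allArr zero n c = Unique.upTo⁺ (suc c)
Unique-allArr (suc d) n c = Unique-allVec _ _ (Unique-allArr d (n ∘ Fin.suc) c)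

module Σℕ = ListFold +-0-commutativeMonoid

≤-sum-map : ∀ {A : Set} (f : A → ℕ) (xs : List A) {x} → x ∈ xs → f x ≤ sum (map f xs)
≤-sum-map f (y ∷ xs) (here refl) = ℕ.m≤m+n _ _
≤-sum-map f (y ∷ xs) (there x∈) = ≤-trans (≤-sum-map f xs x∈) (ℕ.m≤n+m _ _)

sum-map-allFin : ∀ m (g : ℕ → ℕ) → sum (map (g ∘ toℕ) (allFin m)) ≡ sum (map g (upTo m))
sum-map-allFin m g =
  cong sum (trans (map-tabulate id (g ∘ toℕ)) (trans (tabulate≡applyUpTo m g) (sym (map-applyUpTo id g m))))
  where
  tabulate≡applyUpTo : ∀ m (f : ℕ → ℕ) → Data.List.tabulate {n = m} (f ∘ toℕ) ≡ applyUpTo f m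
  tabulate≡applyUpTo zero f = refl
  tabulate≡applyUpTo (suc m) f = cong (f 0 ∷_) (tabulate≡applyUpTo m (f ∘ suc))

sum-map-filter : ∀ {A : Set} {P : A → Set} (P? : ∀ x → Dec (P x)) (f : A → ℕ) xs →
  sum (map f (filter P? xs)) ≡ sum (map (λ x → if does (P? x) then f x else 0) xs)
sum-map-filter P? f [] = refl
sum-map-filter P? f (x ∷ xs) with does (P? x)
... | true = cong (f x +_) (sum-map-filter P? f xs)
... | false = sum-map-filter P? f xs

boxSum : (d : ℕ) (n : Fin d → ℕ) → (Point d → ℕ) → ℕ
boxSum zero n f = f (λ ())
boxSum (suc d) n f = sum (map (λ i → boxSum d (n ∘ Fin.suc) (f ∘ consP i)) (upTo (n Fin.zero)))

boxSum-cong : ∀ d (n : Fin d → ℕ) (f g : Point d → ℕ) → (∀ p → InBox n p → f p ≡ g p) → boxSum d n f ≡ boxSum d n g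
boxSum-cong zero n f g f≐g = f≐g (λ ()) (λ ())
boxSum-cong (suc d) n f g f≐g = Σℕ.fold-map-cong-∈ _ _ (upTo (n Fin.zero)) (λ i∈ → boxSum-cong d (n ∘ Fin.suc) _ _
  (λ q q∈ → f≐g (consP _ q) (λ { Fin.zero → ∈-upTo⁻ i∈ ; (Fin.suc ℓ) → q∈ ℓ })))

boxSum-zero : ∀ d (n : Fin d → ℕ) (f : Point d → ℕ) → (∀ p → InBox n p → f p ≡ 0) → boxSum d n f ≡ 0
boxSum-zero d n f f≐0 = trans (boxSum-cong d n f (λ _ → 0) f≐0) (zero-sum d n)
  where
  zero-sum : ∀ d (n : Fin d → ℕ) → boxSum d n (λ _ → 0) ≡ 0
  zero-sum zero n = refl
  zero-sum (suc d) n = Σℕ.fold-map-ε _ (upTo (n Fin.zero)) (λ _ → zero-sum d (n ∘ Fin.suc))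

boxSum-+ : ∀ d (n : Fin d → ℕ) (f g : Point d → ℕ) → boxSum d n (λ p → f p + g p) ≡ boxSum d n f + boxSum d n g
boxSum-+ zero n f g = refl
boxSum-+ (suc d) n f g = trans (Σℕ.fold-map-cong _ _ (upTo (n Fin.zero)) (λ i → boxSum-+ d (n ∘ Fin.suc) _ _))
                               (Σℕ.fold-map-∙ _ _ (upTo (n Fin.zero)))

sum-map-boxSum : ∀ {A : Set} d (n : Fin d → ℕ) (xs : List A) (f : A → Point d → ℕ) →
  sum (map (λ x → boxSum d n (f x)) xs) ≡ boxSum d n (λ p → sum (map (λ x → f x p) xs))
sum-map-boxSum d n [] f = sym (boxSum-zero d n _ (λ _ _ → refl))
sum-map-boxSum d n (x ∷ xs) f = trans (cong (boxSum d n (f x) +_) (sum-map-boxSum d n xs f)) (sym (boxSum-+ d n _ _))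

≤-boxSum : ∀ d (n : Fin d → ℕ) (f : Point d → ℕ) → Respects≗ f → ∀ p → InBox n p → f p ≤ boxSum d n f
≤-boxSum zero n f f-resp p _ = ≤-reflexive (f-resp (λ ()))
≤-boxSum (suc d) n f f-resp p p∈ = ≤-trans
  (subst (_≤ boxSum d (n ∘ Fin.suc) (f ∘ consP (p Fin.zero))) (f-resp (consP-η p))
    (≤-boxSum d (n ∘ Fin.suc) (f ∘ consP (p Fin.zero)) (f-resp ∘ consP-cong refl) (p ∘ Fin.suc) (p∈ ∘ Fin.suc)))
  (≤-sum-map (λ i → boxSum d (n ∘ Fin.suc) (f ∘ consP i)) (upTo (n Fin.zero)) (∈-upTo⁺ (p∈ Fin.zero)))

boxSum-≤ : ∀ d (n : Fin d → ℕ) (f : Point d → ℕ) c → (∀ p → f p ≤ c) → boxSum d n f ≤ c * boxSum d n (λ _ → 1)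
boxSum-≤ zero n f c f≤c = subst (f (λ ()) ≤_) (sym (ℕ.*-identityʳ c)) (f≤c _)
boxSum-≤ (suc d) n f c f≤c = ≤-trans (termwise (upTo (n Fin.zero))) (≤-reflexive (sym (*-sum (upTo (n Fin.zero)))))
  where
  vol = boxSum d (n ∘ Fin.suc) (λ _ → 1)
  termwise : ∀ is → sum (map (λ i → boxSum d (n ∘ Fin.suc) (f ∘ consP i)) is) ≤ sum (map (λ _ → c * vol) is)
  termwise [] = z≤n
  termwise (i ∷ is) = ℕ.+-mono-≤ (boxSum-≤ d (n ∘ Fin.suc) _ c (f≤c ∘ consP i)) (termwise is)
  *-sum : ∀ is → c * sum (map (λ _ → vol) is) ≡ sum (map (λ _ → c * vol) is)
  *-sum [] = ℕ.*-zeroʳ c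
  *-sum (i ∷ is) = trans (ℕ.*-distribˡ-+ c _ _) (cong (c * vol +_) (*-sum is))

sum-allBox : ∀ d (n : Fin d → ℕ) (f : Point d → ℕ) → Respects≗ f → sum (map (f ∘ toPt) (allBox d n)) ≡ boxSum d n f
sum-allBox zero n f f-resp = trans (ℕ.+-identityʳ _) (f-resp (λ ()))
sum-allBox (suc d) n f f-resp =
  trans (Σℕ.fold-map-concatMap (f ∘ toPt) (λ i → map (consB {n = n} i) (allBox d (n ∘ Fin.suc))) (allFin (n Fin.zero)))
  (trans (Σℕ.fold-map-cong (λ i → sum (map (f ∘ toPt) (map (consB {n = n} i) (allBox d (n ∘ Fin.suc))))) (λ i → boxSum d (n ∘ Fin.suc) (f ∘ consP (toℕ i))) (allFin (n Fin.zero)) row)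
         (sum-map-allFin (n Fin.zero) (λ i → boxSum d (n ∘ Fin.suc) (f ∘ consP i))))
  where
  row : ∀ i → sum (map (f ∘ toPt) (map (consB {n = n} i) (allBox d (n ∘ Fin.suc)))) ≡ boxSum d (n ∘ Fin.suc) (f ∘ consP (toℕ i))
  row i =
    trans (Σℕ.fold-map-map (f ∘ toPt) (consB {n = n} i) (allBox d (n ∘ Fin.suc)))
    (trans (Σℕ.fold-map-cong (λ b → f (toPt (consB {n = n} i b))) (λ b → f (consP (toℕ i) (toPt b))) (allBox d (n ∘ Fin.suc))
              (λ b → f-resp {p = toPt (consB {n = n} i b)} {q = consP (toℕ i) (toPt b)} (λ { Fin.zero → refl ; (Fin.suc ℓ) → refl })))
           (sum-allBox d (n ∘ Fin.suc) (f ∘ consP (toℕ i)) (f-resp ∘ consP-cong refl)))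

slice : ∀ {d} → Fin d → ℕ → (Point d → ℕ) → Point d → ℕ
slice ℓ i f p = if p ℓ ≡ᵇ i then f p else 0

slice-resp-≗ : ∀ {d} ℓ i (f : Point d → ℕ) → Respects≗ f → Respects≗ (slice ℓ i f)
slice-resp-≗ ℓ i f f-resp {p} {q} p≗q rewrite p≗q ℓ with q ℓ ≡ᵇ i
... | true = f-resp p≗q
... | false = refl

Bsum≡boxSum-slice : ∀ {d} {n : Fin d → ℕ} (A : Arr d n) ℓ i → Bsum A ℓ i ≡ boxSum d n (slice ℓ i (entry A))
Bsum≡boxSum-slice {d} {n} A ℓ i = trans (sum-map-filter (λ b → toℕ (b ℓ) ℕ.≟ i) (entry A ∘ toPt) (allBox d n))
  (sum-allBox d n (slice ℓ i (entry A)) (slice-resp-≗ ℓ i (entry A) (entry-resp-≗ A)))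

applyUpTo-ix : ∀ (t : List ℕ) → applyUpTo (ix t) (length t) ≡ t
applyUpTo-ix [] = refl
applyUpTo-ix (x ∷ t) = cong (x ∷_) (applyUpTo-ix t)

ix-∈ : ∀ (t : List ℕ) j → j < length t → ix t j ∈ t
ix-∈ (x ∷ t) zero _ = here refl
ix-∈ (x ∷ t) (suc j) (s≤s j<) = there (ix-∈ t j j<)

sum-reindex : ∀ m (t : List ℕ) → Unique t → All (_< m) t → length t ≤ m → (F G : ℕ → ℕ) →
  (∀ i → i < m → i ∉ t → F i ≡ 0) → (∀ j → length t ≤ j → G j ≡ 0) →
  (∀ j → j < length t → F (ix t j) ≡ G j) → sum (map F (upTo m)) ≡ sum (map G (upTo m))
sum-reindex m t u t<m len≤m F G F-off G-off F∘ix≡G = begin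
  sum (map F (upTo m))
    ≡⟨ Σℕ.fold-map-support ℕ._≟_ F (upTo m) t (Unique.upTo⁺ m) u
         (∈-upTo⁺ ∘ All.lookup t<m) (λ i∈ i∉ → F-off _ (∈-upTo⁻ i∈) i∉) ⟩
  sum (map F t)
    ≡⟨ cong (sum ∘ map F) (sym (applyUpTo-ix t)) ⟩
  sum (map F (applyUpTo (ix t) (length t)))
    ≡⟨ cong sum (trans (map-applyUpTo (ix t) F (length t)) (sym (map-applyUpTo id (F ∘ ix t) (length t)))) ⟩
  sum (map (F ∘ ix t) (upTo (length t)))
    ≡⟨ Σℕ.fold-map-cong-∈ (F ∘ ix t) G (upTo (length t)) (F∘ix≡G _ ∘ ∈-upTo⁻) ⟩
  sum (map G (upTo (length t)))
    ≡⟨ sym (Σℕ.fold-map-support ℕ._≟_ G (upTo m) (upTo (length t)) (Unique.upTo⁺ m) (Unique.upTo⁺ _)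
              (λ j∈ → ∈-upTo⁺ (<-≤-trans (∈-upTo⁻ j∈) len≤m)) (λ _ j∉ → G-off _ (ℕ.≮⇒≥ (j∉ ∘ ∈-upTo⁺)))) ⟩
  sum (map G (upTo m)) ∎
  where open ≡-Reasoning

boxSum-reindex : ∀ d (n : Fin d → ℕ) (t : Fin d → List ℕ) → (∀ ℓ → Unique (t ℓ)) → (∀ ℓ → All (_< n ℓ) (t ℓ)) →
  (∀ ℓ → length (t ℓ) ≤ n ℓ) → (f g : Point d → ℕ) → Respects≗ f → Respects≗ g →
  (∀ p ℓ → p ℓ ∉ t ℓ → f p ≡ 0) → (∀ q ℓ → length (t ℓ) ≤ q ℓ → g q ≡ 0) →
  (∀ q → (∀ ℓ → q ℓ < length (t ℓ)) → f (λ ℓ → ix (t ℓ) (q ℓ)) ≡ g q) → boxSum d n f ≡ boxSum d n g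
boxSum-reindex zero n t _ _ _ f g f-resp g-resp _ _ f∘ix≡g =
  trans (f-resp (λ ())) (trans (f∘ix≡g (λ ()) (λ ())) (g-resp (λ ())))
boxSum-reindex (suc d) n t u t<n len≤n f g f-resp g-resp f-off g-off f∘ix≡g =
  sum-reindex (n Fin.zero) (t Fin.zero) (u Fin.zero) (t<n Fin.zero) (len≤n Fin.zero)
    (λ i → boxSum d (n ∘ Fin.suc) (f ∘ consP i))
    (λ j → boxSum d (n ∘ Fin.suc) (g ∘ consP j))
    (λ i _ i∉ → boxSum-zero d (n ∘ Fin.suc) _ (λ q _ → f-off (consP i q) Fin.zero i∉))
    (λ j j≥ → boxSum-zero d (n ∘ Fin.suc) _ (λ q _ → g-off (consP j q) Fin.zero j≥))
    (λ j j< → boxSum-reindex d (n ∘ Fin.suc) (t ∘ Fin.suc) (u ∘ Fin.suc) (t<n ∘ Fin.suc) (len≤n ∘ Fin.suc)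
       (f ∘ consP (ix (t Fin.zero) j)) (g ∘ consP j)
       (f-resp ∘ consP-cong refl) (g-resp ∘ consP-cong refl)
       (λ p ℓ p∉ → f-off (consP _ p) (Fin.suc ℓ) p∉)
       (λ q ℓ q≥ → g-off (consP j q) (Fin.suc ℓ) q≥)
       (λ q q< → trans (f-resp (λ { Fin.zero → refl ; (Fin.suc ℓ) → refl }))
                       (f∘ix≡g (consP j q) (λ { Fin.zero → j< ; (Fin.suc ℓ) → q< ℓ }))))

-- Last passage values

maximum : List ℕ → ℕ
maximum = foldr _⊔_ 0

module Maxℕ = ListFold ⊔-0-commutativeMonoid

≤-maximum-map : ∀ {A : Set} (f : A → ℕ) (xs : List A) {x} → x ∈ xs → f x ≤ maximum (map f xs)
≤-maximum-map f (y ∷ xs) (here refl) = ℕ.m≤m⊔n _ _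
≤-maximum-map f (y ∷ xs) (there x∈) = ≤-trans (≤-maximum-map f xs x∈) (ℕ.m≤n⊔m _ _)

maximum-map-lub : ∀ {A : Set} (f : A → ℕ) (xs : List A) c → (∀ {x} → x ∈ xs → f x ≤ c) → maximum (map f xs) ≤ c
maximum-map-lub f [] c _ = z≤n
maximum-map-lub f (y ∷ xs) c f≤c = ℕ.⊔-lub (f≤c (here refl)) (maximum-map-lub f xs c (f≤c ∘ there))

maximum-map-mono : ∀ {A : Set} (f g : A → ℕ) (xs : List A) → (∀ x → f x ≤ g x) → maximum (map f xs) ≤ maximum (map g xs)
maximum-map-mono f g [] _ = z≤n
maximum-map-mono f g (y ∷ xs) f≤g = ℕ.⊔-mono-≤ (f≤g y) (maximum-map-mono f g xs f≤g)

maximum-map-+ : ∀ {A : Set} (c : ℕ) (f : A → ℕ) (xs : List A) {z} → z ∈ xs →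
  maximum (map (λ x → c + f x) xs) ≡ c + maximum (map f xs)
maximum-map-+ c f (y ∷ []) _ = trans (ℕ.⊔-identityʳ _) (cong (c +_) (sym (ℕ.⊔-identityʳ _)))
maximum-map-+ c f (y ∷ y′ ∷ xs) _ =
  trans (cong ((c + f y) ⊔_) (maximum-map-+ c f (y′ ∷ xs) (here refl))) (sym (ℕ.+-distribˡ-⊔ c _ _))

maxDir : ∀ {d} → (Fin d → ℕ) → ℕ
maxDir {d} f = maximum (map f (allFin d))

≤-maxDir : ∀ {d} (f : Fin d → ℕ) ℓ → f ℓ ≤ maxDir f
≤-maxDir {d} f ℓ = ≤-maximum-map f (allFin d) (∈-allFin ℓ)

maxDir-lub : ∀ {d} (f : Fin d → ℕ) c → (∀ ℓ → f ℓ ≤ c) → maxDir f ≤ c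
maxDir-lub {d} f c f≤c = maximum-map-lub f (allFin d) c (λ {ℓ} _ → f≤c ℓ)

maxDir-cong : ∀ {d} (f g : Fin d → ℕ) → (∀ ℓ → f ℓ ≡ g ℓ) → maxDir f ≡ maxDir g
maxDir-cong {d} f g = Maxℕ.fold-map-cong f g (allFin d)

maxDir-mono : ∀ {d} (f g : Fin d → ℕ) → (∀ ℓ → f ℓ ≤ g ℓ) → maxDir f ≤ maxDir g
maxDir-mono {d} f g = maximum-map-mono f g (allFin d)

maxDir-zero : ∀ {d} (f : Fin d → ℕ) → (∀ ℓ → f ℓ ≡ 0) → maxDir f ≡ 0
maxDir-zero f f≡0 = ℕ.n≤0⇒n≡0 (maxDir-lub f 0 (≤-reflexive ∘ f≡0))

δ : ∀ {d} → Fin d → Fin d → ℕ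
δ ℓ ℓ′ = if does (ℓ′ ≟F ℓ) then 1 else 0

suc-sum≡sum : ∀ {d} (f g : Fin d → ℕ) ℓ → (∀ ℓ′ → f ℓ′ + δ ℓ ℓ′ ≡ g ℓ′) →
  suc (sum (map f (allFin d))) ≡ sum (map g (allFin d))
suc-sum≡sum {d} f g ℓ f+δ≡g =
  trans (ℕ.+-comm 1 _) (trans (cong (sum (map f (allFin d)) +_) (sym sum-δ))
    (trans (sym (Σℕ.fold-map-∙ f (δ ℓ) (allFin d))) (Σℕ.fold-map-cong _ _ (allFin d) f+δ≡g)))
  where
  δ-off : ∀ {ℓ′} → ℓ′ ∈ allFin d → ℓ′ ≢ ℓ → δ ℓ ℓ′ ≡ 0
  δ-off {ℓ′} _ ℓ′≢ℓ with ℓ′ ≟F ℓ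
  ... | yes ℓ′≡ℓ = ⊥-elim (ℓ′≢ℓ ℓ′≡ℓ)
  ... | no _ = refl
  δ-on : δ ℓ ℓ ≡ 1
  δ-on with ℓ ≟F ℓ
  ... | yes _ = refl
  ... | no ℓ≢ℓ = ⊥-elim (ℓ≢ℓ refl)
  sum-δ : sum (map (δ ℓ) (allFin d)) ≡ 1
  sum-δ = trans (Σℕ.fold-map-single (δ ℓ) (allFin d) ℓ (Unique.allFin⁺ d) (∈-allFin ℓ) δ-off) δ-on

≤-bump : ∀ {d} (p : Point d) ℓ ℓ′ → p ℓ′ ≤ bump p ℓ ℓ′
≤-bump p ℓ ℓ′ with ℓ′ ≟F ℓ
... | yes _ = ℕ.n≤1+n _
... | no _ = ≤-refl

bump-cong : ∀ {d} {p q : Point d} ℓ → p ≗ q → bump p ℓ ≗ bump q ℓ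
bump-cong ℓ p≗q ℓ′ with ℓ′ ≟F ℓ
... | yes _ = cong suc (p≗q ℓ′)
... | no _ = p≗q ℓ′

passage : ∀ {d} → (Point d → ℕ) → ℕ → Point d → ℕ
passage a zero p = a p
passage a (suc k) p = a p + maxDir (λ ℓ → passage a k (bump p ℓ))

passage-resp-≗ : ∀ {d} (a : Point d → ℕ) → Respects≗ a → ∀ k → Respects≗ (passage a k)
passage-resp-≗ a a-resp zero p≗q = a-resp p≗q
passage-resp-≗ a a-resp (suc k) p≗q =
  cong₂ _+_ (a-resp p≗q) (maxDir-cong _ _ (λ ℓ → passage-resp-≗ a a-resp k (bump-cong ℓ p≗q)))

passage-≤-suc : ∀ {d} (a : Point d → ℕ) k p → passage a k p ≤ passage a (suc k) p
passage-≤-suc a zero p = ℕ.m≤m+n _ _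
passage-≤-suc a (suc k) p = ℕ.+-monoʳ-≤ (a p) (maxDir-mono _ _ (λ ℓ → passage-≤-suc a k (bump p ℓ)))

passage-mono : ∀ {d} (a : Point d → ℕ) {k k′} p → k ≤ k′ → passage a k p ≤ passage a k′ p
passage-mono a {k′ = k′} p z≤n = go k′
  where
  go : ∀ k → passage a 0 p ≤ passage a k p
  go zero = ≤-refl
  go (suc k) = ≤-trans (go k) (passage-≤-suc a k p)
passage-mono a {suc k} {suc k′} p (s≤s k≤k′) = ℕ.+-monoʳ-≤ (a p)
  (maxDir-mono _ _ (λ ℓ → passage-mono a (bump p ℓ) k≤k′))

Supported : ∀ {d} → (Point d → ℕ) → (Fin d → ℕ) → Set
Supported a m = ∀ p ℓ → m ℓ ≤ p ℓ → a p ≡ 0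

passage-outside : ∀ {d} (a : Point d → ℕ) (m : Fin d → ℕ) → Supported a m → ∀ k p ℓ → m ℓ ≤ p ℓ → passage a k p ≡ 0
passage-outside a m a-sup zero p ℓ m≤p = a-sup p ℓ m≤p
passage-outside a m a-sup (suc k) p ℓ m≤p = cong₂ _+_ (a-sup p ℓ m≤p)
  (maxDir-zero _ (λ ℓ′ → passage-outside a m a-sup k (bump p ℓ′) ℓ (≤-trans m≤p (≤-bump p ℓ′ ℓ))))

passage-¬InBox : ∀ {d} (a : Point d → ℕ) (m : Fin d → ℕ) → Supported a m → ∀ k p → ¬ InBox m p → passage a k p ≡ 0
passage-¬InBox a m a-sup k p p∉ = let ℓ , m≤p = ¬InBox⇒outside m p p∉ in passage-outside a m a-sup k p ℓ m≤p

-- Bounds the number of steps of a path from p inside the box m.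
distToCorner : ∀ {d} → (Fin d → ℕ) → Point d → ℕ
distToCorner {d} m p = sum (map (λ ℓ → m ℓ ∸ p ℓ) (allFin d))

distToCorner-bump : ∀ {d} (m : Fin d → ℕ) p ℓ → p ℓ < m ℓ → suc (distToCorner m (bump p ℓ)) ≡ distToCorner m p
distToCorner-bump m p ℓ p<m = suc-sum≡sum _ _ ℓ step
  where
  step : ∀ ℓ′ → (m ℓ′ ∸ bump p ℓ ℓ′) + δ ℓ ℓ′ ≡ m ℓ′ ∸ p ℓ′
  step ℓ′ with ℓ′ ≟F ℓ
  ... | yes refl = trans (ℕ.+-comm _ 1) (sym (ℕ.+-∸-assoc 1 p<m))
  ... | no _ = ℕ.+-identityʳ _

distToCorner-≤ : ∀ {d} (m : Fin d → ℕ) p → distToCorner m p ≤ pathBound m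
distToCorner-≤ {d} m p = go (allFin d)
  where
  go : ∀ ℓs → sum (map (λ ℓ → m ℓ ∸ p ℓ) ℓs) ≤ sum (map m ℓs)
  go [] = z≤n
  go (ℓ ∷ ℓs) = ℕ.+-mono-≤ (ℕ.m∸n≤m (m ℓ) (p ℓ)) (go ℓs)

distToCorner-pos : ∀ {d} (m : Fin d → ℕ) p → InBox m p → Fin d → 1 ≤ distToCorner m p
distToCorner-pos {d} m p p∈ ℓ₀ =
  ≤-trans (ℕ.m<n⇒0<n∸m (p∈ ℓ₀)) (≤-sum-map (λ ℓ → m ℓ ∸ p ℓ) (allFin d) (∈-allFin ℓ₀))

module _ {d} (ℓ₀ : Fin d) (a : Point d → ℕ) (m : Fin d → ℕ) (a-sup : Supported a m) where

  private
    dist-bump : ∀ {k} p ℓ → InBox m p → distToCorner m p ≤ suc k → distToCorner m (bump p ℓ) ≤ k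
    dist-bump p ℓ p∈ dist≤ = ℕ.≤-pred (subst (_≤ _) (sym (distToCorner-bump m p ℓ (p∈ ℓ))) dist≤)

    ¬dist≤0 : ∀ p → InBox m p → ¬ distToCorner m p ≤ 0
    ¬dist≤0 p p∈ = <⇒≱ (distToCorner-pos m p p∈ ℓ₀)

  passage-stable : ∀ k p → distToCorner m p ≤ k → passage a k p ≡ passage a (suc k) p
  passage-stable k p dist≤ with inBox? m p
  ... | no p∉ = trans (passage-¬InBox a m a-sup k p p∉) (sym (passage-¬InBox a m a-sup (suc k) p p∉))
  passage-stable zero p dist≤ | yes p∈ = ⊥-elim (¬dist≤0 p p∈ dist≤)
  passage-stable (suc k) p dist≤ | yes p∈ =
    cong (a p +_) (maxDir-cong _ _ (λ ℓ → passage-stable k (bump p ℓ) (dist-bump p ℓ p∈ dist≤)))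

  passage-recursion : ∀ k → (∀ p → distToCorner m p ≤ k) →
    ∀ p → passage a k p ≡ a p + maxDir (λ ℓ → passage a k (bump p ℓ))
  passage-recursion k dist≤ p with inBox? m p
  ... | no p∉ = trans (passage-¬InBox a m a-sup k p p∉) (sym (cong₂ _+_ (a-sup p ℓ m≤p)
         (maxDir-zero _ (λ ℓ′ → passage-outside a m a-sup k (bump p ℓ′) ℓ (≤-trans m≤p (≤-bump p ℓ′ ℓ))))))
    where
    ℓ = proj₁ (¬InBox⇒outside m p p∉)
    m≤p = proj₂ (¬InBox⇒outside m p p∉)
  passage-recursion zero dist≤ p | yes p∈ = ⊥-elim (¬dist≤0 p p∈ (dist≤ p))
  passage-recursion (suc k) dist≤ p | yes p∈ =
    cong (a p +_) (maxDir-cong _ _ (λ ℓ → passage-stable k (bump p ℓ) (dist-bump p ℓ p∈ (dist≤ p))))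

  passage-unique : (U : Point d → ℕ) → (∀ p → ¬ InBox m p → U p ≡ 0) →
    (∀ p → InBox m p → U p ≡ a p + maxDir (λ ℓ → U (bump p ℓ))) →
    ∀ k p → distToCorner m p ≤ k → U p ≡ passage a k p
  passage-unique U U-out U-rec k p dist≤ with inBox? m p
  ... | no p∉ = trans (U-out p p∉) (sym (passage-¬InBox a m a-sup k p p∉))
  passage-unique U U-out U-rec zero p dist≤ | yes p∈ = ⊥-elim (¬dist≤0 p p∈ dist≤)
  passage-unique U U-out U-rec (suc k) p dist≤ | yes p∈ = trans (U-rec p p∈)
    (cong (a p +_) (maxDir-cong _ _ (λ ℓ → passage-unique U U-out U-rec k (bump p ℓ) (dist-bump p ℓ p∈ dist≤))))

maximum-weightFrom≡passage : ∀ {d} {n : Fin d → ℕ} (A : Arr d n) (ℓ₀ : Fin d) k p →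
  maximum (map (weightFrom A p) (listsOver k (allFin d))) ≡ passage (entry A) k p
maximum-weightFrom≡passage A ℓ₀ zero p = ℕ.⊔-identityʳ _
maximum-weightFrom≡passage {d} A ℓ₀ (suc k) p =
  trans (Maxℕ.fold-map-concatMap (weightFrom A p) (λ ℓ → map (ℓ ∷_) (listsOver k (allFin d))) (allFin d))
  (trans (Maxℕ.fold-map-cong _ (λ ℓ → entry A p + passage (entry A) k (bump p ℓ)) (allFin d) first-step)
         (maximum-map-+ (entry A p) (λ ℓ → passage (entry A) k (bump p ℓ)) (allFin d) (∈-allFin ℓ₀)))
  where
  replicate∈ : replicate k ℓ₀ ∈ listsOver k (allFin d)
  replicate∈ = subst (λ j → replicate k ℓ₀ ∈ listsOver j (allFin d)) (length-replicate k)
    (∈-listsOver⁺ (allFin d) (replicate k ℓ₀) (All.tabulate (λ {ℓ} _ → ∈-allFin ℓ)))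
  first-step : ∀ ℓ → maximum (map (weightFrom A p) (map (ℓ ∷_) (listsOver k (allFin d))))
                     ≡ entry A p + passage (entry A) k (bump p ℓ)
  first-step ℓ =
    trans (Maxℕ.fold-map-map (weightFrom A p) (ℓ ∷_) (listsOver k (allFin d)))
    (trans (maximum-map-+ (entry A p) (weightFrom A (bump p ℓ)) (listsOver k (allFin d)) replicate∈)
           (cong (entry A p +_) (maximum-weightFrom≡passage A ℓ₀ k (bump p ℓ))))

G≡passage : ∀ {d} {n : Fin d → ℕ} (A : Arr d n) (ℓ₀ : Fin d) → G A ≡ passage (entry A) (pathBound n) origin
G≡passage {d} {n} A ℓ₀ =
  trans (Maxℕ.fold-map-concatMap (weightFrom A origin) (λ k → listsOver k (allFin d)) ks)
  (trans (Maxℕ.fold-map-cong _ (λ k → passage (entry A) k origin) ks (λ k → maximum-weightFrom≡passage A ℓ₀ k origin))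
         (≤-antisym (maximum-map-lub _ ks _ (λ k∈ → passage-mono (entry A) origin (ℕ.≤-pred (∈-upTo⁻ k∈))))
                    (≤-maximum-map (λ k → passage (entry A) k origin) ks (∈-upTo⁺ ≤-refl))))
  where
  ks = upTo (suc (pathBound n))

-- Partitions as last passage values

∈-allBox : ∀ d (n : Fin d → ℕ) (p : Point d) → InBox n p → ∃[ b ] (b ∈ allBox d n × toPt b ≗ p)
∈-allBox zero n p _ = (λ ()) , here refl , (λ ())
∈-allBox (suc d) n p p∈ with ∈-allBox d (n ∘ Fin.suc) (p ∘ Fin.suc) (p∈ ∘ Fin.suc)
... | b , b∈ , b≗p = consB {n = n} i₀ b ,
      ∈-concatMap⁺ (λ i → map (consB {n = n} i) (allBox d (n ∘ Fin.suc))) (row (∈-allFin i₀)) ,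
      (λ { Fin.zero → toℕ-fromℕ< (p∈ Fin.zero) ; (Fin.suc ℓ) → b≗p ℓ })
  where
  i₀ = fromℕ< (p∈ Fin.zero)
  row : ∀ {is} → i₀ ∈ is → Any (λ i → consB {n = n} i₀ b ∈ map (consB {n = n} i) (allBox d (n ∘ Fin.suc))) is
  row (here refl) = here (∈-map⁺ (consB {n = n} i₀) b∈)
  row (there i₀∈) = there (row i₀∈)

≤-at-origin : ∀ {d} (V : Point d → ℕ) → Respects≗ V → (∀ q ℓ → V (bump q ℓ) ≤ V q) → ∀ p → V p ≤ V origin
≤-at-origin {d} V V-resp V-antitone p = go _ p refl
  where
  lower : Point d → Fin d → Point d
  lower p ℓ ℓ′ = if does (ℓ′ ≟F ℓ) then pred (p ℓ′) else p ℓ′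
  go : ∀ s p → sum (map p (allFin d)) ≡ s → V p ≤ V origin
  go s p _ with all? (λ ℓ → p ℓ ℕ.≟ 0)
  ... | yes p≗0 = ≤-reflexive (V-resp p≗0)
  go zero p sum≡0 | no p≠0 = let ℓ , pℓ≢0 = ¬∀⟶∃¬ d _ (λ ℓ → p ℓ ℕ.≟ 0) p≠0 in
     ⊥-elim (pℓ≢0 (ℕ.n≤0⇒n≡0 (subst (p ℓ ≤_) sum≡0 (≤-sum-map p (allFin d) (∈-allFin ℓ)))))
  go (suc s) p sum≡ | no p≠0 with ¬∀⟶∃¬ d _ (λ ℓ → p ℓ ℕ.≟ 0) p≠0
  ... | ℓ , pℓ≢0 = ≤-trans (≤-reflexive (V-resp (sym ∘ bump-lower))) (≤-trans (V-antitone (lower p ℓ) ℓ)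
        (go s (lower p ℓ) (ℕ.suc-injective (trans (suc-sum≡sum (lower p ℓ) p ℓ lower+δ) sum≡))))
    where
    suc-pred : suc (pred (p ℓ)) ≡ p ℓ
    suc-pred = ℕ.suc-pred (p ℓ) {{ℕ.≢-nonZero pℓ≢0}}
    bump-lower : ∀ ℓ′ → bump (lower p ℓ) ℓ ℓ′ ≡ p ℓ′
    bump-lower ℓ′ with ℓ′ ≟F ℓ
    ... | yes refl = suc-pred
    ... | no _ = refl
    lower+δ : ∀ ℓ′ → lower p ℓ ℓ′ + δ ℓ ℓ′ ≡ p ℓ′
    lower+δ ℓ′ with ℓ′ ≟F ℓ
    ... | yes refl = trans (ℕ.+-comm _ 1) suc-pred
    ... | no _ = ℕ.+-identityʳ _

filterᵇ-cong : ∀ {A : Set} (p q : A → Bool) (xs : List A) → (∀ {x} → x ∈ xs → p x ≡ q x) → filterᵇ p xs ≡ filterᵇ q xs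
filterᵇ-cong p q [] _ = refl
filterᵇ-cong p q (x ∷ xs) p≐q with p x | q x | p≐q (here refl)
... | true | true | _ = cong (x ∷_) (filterᵇ-cong p q xs (p≐q ∘ there))
... | false | false | _ = filterᵇ-cong p q xs (p≐q ∘ there)

count-++ : ∀ {A : Set} (p : A → Bool) (xs ys : List A) →
  length (filterᵇ p (xs ++ ys)) ≡ length (filterᵇ p xs) + length (filterᵇ p ys)
count-++ p [] ys = refl
count-++ p (x ∷ xs) ys with p x
... | true = cong suc (count-++ p xs ys)
... | false = count-++ p xs ys

count-above : ∀ M v → length (filterᵇ (M <ᵇ_) (map suc (upTo v))) ≡ v ∸ M
count-above M zero = sym (ℕ.0∸n≡0 M)
count-above M (suc v) =
  trans (cong (length ∘ filterᵇ (M <ᵇ_)) (trans (cong (map suc) (sym (applyUpTo-∷ʳ id v)))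
                                                (map-++ suc (upTo v) (v ∷ []))))
  (trans (count-++ (M <ᵇ_) (map suc (upTo v)) (suc v ∷ []))
  (trans (cong (_+ length (filterᵇ (M <ᵇ_) (suc v ∷ []))) (count-above M v)) last))
  where
  last : (v ∸ M) + length (filterᵇ (M <ᵇ_) (suc v ∷ [])) ≡ suc v ∸ M
  last with M <ᵇ suc v in eq
  ... | true = trans (ℕ.+-comm _ 1) (sym (ℕ.+-∸-assoc 1 {v} {M} (ℕ.≤-pred (<ᵇ-true⁻ {M} eq))))
  ... | false = trans (ℕ.+-identityʳ _) (trans (ℕ.m≤n⇒m∸n≡0 (≤-trans (ℕ.n≤1+n v) (<ᵇ-false⁻ {M} eq)))
                                                (sym (ℕ.m≤n⇒m∸n≡0 (<ᵇ-false⁻ {M} eq))))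

cornersAt : ∀ {d} {n : Fin d → ℕ} → Arr d n → Point d → ℕ
cornersAt {d} π p = length (filterᵇ (λ k → allᵇ (λ ℓ → entry π (bump p ℓ) <ᵇ k) (allFin d)) (map suc (upTo (entry π p))))

cornersAt≡ : ∀ {d} {n : Fin d → ℕ} (π : Arr d n) p → cornersAt π p ≡ entry π p ∸ maxDir (λ ℓ → entry π (bump p ℓ))
cornersAt≡ {d} π p = trans (cong length (filterᵇ-cong _ _ (map suc (upTo (entry π p))) above-all⇔above-max))
                           (count-above _ (entry π p))
  where
  f = λ ℓ → entry π (bump p ℓ)
  above-all⇔above-max : ∀ {k} → k ∈ map suc (upTo (entry π p)) → allᵇ (λ ℓ → f ℓ <ᵇ k) (allFin d) ≡ (maxDir f <ᵇ k)
  above-all⇔above-max k∈ with ∈-map⁻ suc k∈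
  ... | j , _ , refl = Bool-ext
    (λ all< → <ᵇ-true⁺ (s≤s (maxDir-lub f j (λ ℓ → ℕ.≤-pred (<ᵇ-true⁻ {f ℓ} (allᵇ⁻ (λ ℓ → f ℓ <ᵇ suc j) (allFin d) all< (∈-allFin ℓ)))))))
    (λ max< → allᵇ⁺ (λ ℓ → f ℓ <ᵇ suc j) (allFin d) (λ {ℓ} _ → <ᵇ-true⁺ (≤-<-trans (≤-maxDir f ℓ) (<ᵇ-true⁻ {maxDir f} {suc j} max<))))

cornersAt-resp-≗ : ∀ {d} {n : Fin d → ℕ} (π : Arr d n) → Respects≗ (cornersAt π)
cornersAt-resp-≗ π {p} {q} p≗q = trans (cornersAt≡ π p)
  (trans (cong₂ _∸_ (entry-resp-≗ π p≗q) (maxDir-cong _ _ (λ ℓ → entry-resp-≗ π (bump-cong ℓ p≗q))))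
         (sym (cornersAt≡ π q)))

cornersAt-¬InBox : ∀ {d} {n : Fin d → ℕ} (π : Arr d n) p → ¬ InBox n p → cornersAt π p ≡ 0
cornersAt-¬InBox π p p∉ = trans (cornersAt≡ π p) (trans (cong (_∸ maxDir (λ ℓ → entry π (bump p ℓ))) (entry-¬InBox π p p∉)) (ℕ.0∸n≡0 (maxDir (λ ℓ → entry π (bump p ℓ)))))

cornerArr : ∀ {d} {n : Fin d → ℕ} → Arr d n → Arr d n
cornerArr π = tabulateArr (cornersAt π)

entry-cornerArr : ∀ {d} {n : Fin d → ℕ} (π : Arr d n) p → entry (cornerArr π) p ≡ cornersAt π p
entry-cornerArr π = entry-tabulateArr′ (cornersAt π) (cornersAt-resp-≗ π) (cornersAt-¬InBox π)

module LastPassage {d} (ℓ₀ : Fin d) (n : Fin d → ℕ) where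

  lastPassage : Arr d n → Point d → ℕ
  lastPassage A = passage (entry A) (pathBound n)

  lastPassage-recursion : (A : Arr d n) → ∀ p → lastPassage A p ≡ entry A p + maxDir (λ ℓ → lastPassage A (bump p ℓ))
  lastPassage-recursion A = passage-recursion ℓ₀ (entry A) n (entry-outside A) (pathBound n) (distToCorner-≤ n)

  lastPassage-resp-≗ : (A : Arr d n) → Respects≗ (lastPassage A)
  lastPassage-resp-≗ A = passage-resp-≗ (entry A) (entry-resp-≗ A) (pathBound n)

  lastPassage-antitone : (A : Arr d n) → ∀ q ℓ → lastPassage A (bump q ℓ) ≤ lastPassage A q
  lastPassage-antitone A q ℓ = subst (lastPassage A (bump q ℓ) ≤_) (sym (lastPassage-recursion A q))
    (≤-trans (≤-maxDir (λ ℓ → lastPassage A (bump q ℓ)) ℓ) (ℕ.m≤n+m _ _))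

  lastPassageArr : Arr d n → Arr d n
  lastPassageArr A = tabulateArr (lastPassage A)

  entry-lastPassageArr : (A : Arr d n) → ∀ p → entry (lastPassageArr A) p ≡ lastPassage A p
  entry-lastPassageArr A = entry-tabulateArr′ (lastPassage A) (lastPassage-resp-≗ A)
    (passage-¬InBox (entry A) n (entry-outside A) (pathBound n))

module PartitionsAsArrays {d} (ℓ₀ : Fin d) (n : Fin d → ℕ) (h : ℕ) where
  open LastPassage ℓ₀ n

  partitions : List (Arr d n)
  partitions = filterᵇ isPartition (allArr d n h)

  arrays : List (Arr d n)
  arrays = filterᵇ (λ A → G A ≤ᵇ h) (allArr d n h)

  partition-antitone : (π : Arr d n) → isPartition π ≡ true → ∀ p ℓ → entry π (bump p ℓ) ≤ entry π p
  partition-antitone π π-part p ℓ with inBox? n p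
  ... | no p∉ = ≤-reflexive (trans (entry-¬InBox π (bump p ℓ) (λ p+e∈ → p∉ (λ ℓ′ → ≤-<-trans (≤-bump p ℓ ℓ′) (p+e∈ ℓ′))))
                                   (sym (entry-¬InBox π p p∉)))
  ... | yes p∈ with ∈-allBox d n p p∈
  ... | b , b∈ , b≗p = subst₂ _≤_ (entry-resp-≗ π (bump-cong ℓ b≗p)) (entry-resp-≗ π b≗p)
        (≤ᵇ-true⁻ (allᵇ⁻ _ (allFin d) (allᵇ⁻ _ (allBox d n) π-part b∈) (∈-allFin ℓ)))

  partition≡lastPassage : (π : Arr d n) → isPartition π ≡ true → ∀ p → entry π p ≡ lastPassage (cornerArr π) p
  partition≡lastPassage π π-part p =
    passage-unique ℓ₀ (entry (cornerArr π)) n (entry-outside (cornerArr π)) (entry π) (entry-¬InBox π)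
      (λ q _ → sym (trans (cong (_+ maxDir (λ ℓ → entry π (bump q ℓ))) (trans (entry-cornerArr π q) (cornersAt≡ π q)))
                           (ℕ.m∸n+n≡m (maxDir-lub _ _ (partition-antitone π π-part q)))))
      (pathBound n) p (distToCorner-≤ n p)

  cornerArr∈arrays : ∀ {π} → π ∈ partitions → cornerArr π ∈ arrays
  cornerArr∈arrays {π} π∈ with ∈-filterᵇ⁻ isPartition {xs = allArr d n h} π∈
  ... | π∈all , π-part = ∈-filterᵇ⁺ _
    (∈-allArr⁺ h (cornerArr π) (λ p → ≤-trans (≤-reflexive (trans (entry-cornerArr π p) (cornersAt≡ π p)))
                                           (≤-trans (ℕ.m∸n≤m (entry π p) (maxDir (λ ℓ → entry π (bump p ℓ)))) (∈-allArr⁻ h π π∈all p))))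
    (≤ᵇ-true⁺ (subst (_≤ h) (trans (partition≡lastPassage π π-part origin) (sym (G≡passage (cornerArr π) ℓ₀)))
                            (∈-allArr⁻ h π π∈all origin)))

  lastPassageArr∘cornerArr : ∀ {π} → π ∈ partitions → lastPassageArr (cornerArr π) ≡ π
  lastPassageArr∘cornerArr {π} π∈ with ∈-filterᵇ⁻ isPartition {xs = allArr d n h} π∈
  ... | _ , π-part = Arr-ext (lastPassageArr (cornerArr π)) π
    (λ p _ → trans (entry-lastPassageArr (cornerArr π) p) (sym (partition≡lastPassage π π-part p)))

  lastPassageArr∈partitions : ∀ {A} → A ∈ arrays → lastPassageArr A ∈ partitions
  lastPassageArr∈partitions {A} A∈ with ∈-filterᵇ⁻ (λ A → G A ≤ᵇ h) {xs = allArr d n h} A∈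
  ... | _ , G≤h = ∈-filterᵇ⁺ _
    (∈-allArr⁺ h (lastPassageArr A) (λ p → subst (_≤ h) (sym (entry-lastPassageArr A p))
       (≤-trans (≤-at-origin (lastPassage A) (lastPassage-resp-≗ A) (lastPassage-antitone A) p)
                (subst (_≤ h) (G≡passage A ℓ₀) (≤ᵇ-true⁻ G≤h)))))
    (allᵇ⁺ _ (allBox d n) (λ {b} _ → allᵇ⁺ _ (allFin d) (λ {ℓ} _ →
       ≤ᵇ-true⁺ (subst₂ _≤_ (sym (entry-lastPassageArr A _)) (sym (entry-lastPassageArr A _))
                            (lastPassage-antitone A (toPt b) ℓ)))))

  cornerArr∘lastPassageArr : ∀ {A} → A ∈ arrays → cornerArr (lastPassageArr A) ≡ A
  cornerArr∘lastPassageArr {A} _ = Arr-ext (cornerArr (lastPassageArr A)) A (λ p _ → begin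
    entry (cornerArr (lastPassageArr A)) p
      ≡⟨ trans (entry-cornerArr (lastPassageArr A) p) (cornersAt≡ (lastPassageArr A) p) ⟩
    entry (lastPassageArr A) p ∸ maxDir (λ ℓ → entry (lastPassageArr A) (bump p ℓ))
      ≡⟨ cong₂ _∸_ (entry-lastPassageArr A p) (maxDir-cong _ _ (λ ℓ → entry-lastPassageArr A (bump p ℓ))) ⟩
    lastPassage A p ∸ maxDir (λ ℓ → lastPassage A (bump p ℓ))
      ≡⟨ cong (_∸ maxDir (λ ℓ → lastPassage A (bump p ℓ))) (lastPassage-recursion A p) ⟩
    (entry A p + maxDir (λ ℓ → lastPassage A (bump p ℓ))) ∸ maxDir (λ ℓ → lastPassage A (bump p ℓ))
      ≡⟨ ℕ.m+n∸n≡m (entry A p) (maxDir (λ ℓ → lastPassage A (bump p ℓ))) ⟩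
    entry A p ∎)
    where open ≡-Reasoning

-- The corner monomial of a partition

𝟙 : Bool → ℕ
𝟙 b = if b then 1 else 0

count≡sum-𝟙 : ∀ {A : Set} (p : A → Bool) xs → length (filterᵇ p xs) ≡ sum (map (𝟙 ∘ p) xs)
count≡sum-𝟙 p [] = refl
count≡sum-𝟙 p (x ∷ xs) with p x
... | true = cong suc (count≡sum-𝟙 p xs)
... | false = count≡sum-𝟙 p xs

count-∷ : ∀ {A : Set} (p : A → Bool) x xs → length (filterᵇ p (x ∷ xs)) ≡ 𝟙 (p x) + length (filterᵇ p xs)
count-∷ p x xs with p x
... | true = refl
... | false = refl

count-corners-in-slice : ∀ {d} {n : Fin d → ℕ} (π : Arr d n) (ℓ : Fin d) (j : ℕ) →
  length (filterᵇ (λ c → toℕ (proj₁ c ℓ) ≡ᵇ j) (corners π)) ≡ boxSum d n (slice ℓ j (cornersAt π))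
count-corners-in-slice {d} {n} π ℓ j =
  trans (count≡sum-𝟙 inSlice (corners π))
  (trans (Σℕ.fold-map-filterᵇ isCorner (𝟙 ∘ inSlice) (concatMap column (allBox d n)))
  (trans (Σℕ.fold-map-concatMap cornerInSlice column (allBox d n))
  (trans (Σℕ.fold-map-cong _ (slice ℓ j (cornersAt π) ∘ toPt) (allBox d n) per-column)
         (sum-allBox d n (slice ℓ j (cornersAt π)) (slice-resp-≗ ℓ j (cornersAt π) (cornersAt-resp-≗ π))))))
  where
  inSlice : Box d n × ℕ → Bool
  inSlice c = toℕ (proj₁ c ℓ) ≡ᵇ j
  isCorner : Box d n × ℕ → Bool
  isCorner c = allᵇ (λ ℓ → entry π (bump (toPt (proj₁ c)) ℓ) <ᵇ proj₂ c) (allFin d)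
  cornerInSlice : Box d n × ℕ → ℕ
  cornerInSlice c = if isCorner c then 𝟙 (inSlice c) else 0
  column : Box d n → List (Box d n × ℕ)
  column b = map (λ k → (b , k)) (map suc (upTo (entry π (toPt b))))
  per-column : ∀ b → sum (map cornerInSlice (column b)) ≡ slice ℓ j (cornersAt π) (toPt b)
  per-column b = trans (Σℕ.fold-map-map cornerInSlice (λ k → (b , k)) ks) (go (toℕ (b ℓ) ≡ᵇ j) refl)
    where
    ks = map suc (upTo (entry π (toPt b)))
    if-same : ∀ t → (if t then 0 else 0) ≡ 0
    if-same true = refl
    if-same false = refl
    go : ∀ c → (toℕ (b ℓ) ≡ᵇ j) ≡ c →
         sum (map (λ k → if isCorner (b , k) then 𝟙 c else 0) ks) ≡ slice ℓ j (cornersAt π) (toPt b)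
    go true e rewrite e = sym (count≡sum-𝟙 (λ k → isCorner (b , k)) ks)
    go false e rewrite e = Σℕ.fold-map-ε _ ks (λ k → if-same (isCorner (b , k)))

module SemiringSums {a l} (R : CommutativeSemiring a l) where
  open CommutativeSemiring R public
    using (_≈_; 0#; 1#; +-commutativeMonoid; *-commutativeMonoid; setoid)
    renaming (Carrier to C; _+_ to _+ᴿ_; _*_ to _*ᴿ_;
              refl to ≈-refl; sym to ≈-sym; trans to ≈-trans; reflexive to ≈-reflexive)

  module ΣR = ListFold +-commutativeMonoid
  module ΠR = ListFold *-commutativeMonoid

  Σ : List C → C
  Σ = Σᴿ R

  Π : List C → C
  Π = Πᴿ R

  _^_ : C → ℕ → C
  _^_ = pow R

module CornerMonomials {a l} (R : CommutativeSemiring a l) where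
  open CommutativeSemiring R using (*-identityˡ; *-identityʳ; *-assoc; *-congˡ; *-cong)
  open SemiringSums R
  open import Relation.Binary.Reasoning.Setoid setoid

  ^-+ : ∀ y i j → y ^ (i + j) ≈ (y ^ i) *ᴿ (y ^ j)
  ^-+ y zero j = ≈-sym (*-identityˡ _)
  ^-+ y (suc i) j = ≈-trans (*-congˡ (^-+ y i j)) (≈-sym (*-assoc _ _ _))

  Π-collect : ∀ {B : Set} {m} (y : Fin m → C) (key : B → Fin m) (bs : List B) →
    Π (map (y ∘ key) bs) ≈ Π (map (λ i → y i ^ length (filterᵇ (λ b → toℕ (key b) ≡ᵇ toℕ i) bs)) (allFin m))
  Π-collect {m = m} y key [] = ≈-sym (ΠR.fold-map-ε _ (allFin m) (λ _ → ≈-refl))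
  Π-collect {m = m} y key (b ∷ bs) = begin
    y (key b) *ᴿ Π (map (y ∘ key) bs)
      ≈⟨ *-cong (≈-sym key-only) (Π-collect y key bs) ⟩
    Π (map (λ i → y i ^ 𝟙 (isKey b i)) (allFin m)) *ᴿ Π (map (λ i → y i ^ count i bs) (allFin m))
      ≈⟨ ≈-sym (ΠR.fold-map-∙ _ _ (allFin m)) ⟩
    Π (map (λ i → (y i ^ 𝟙 (isKey b i)) *ᴿ (y i ^ count i bs)) (allFin m))
      ≈⟨ ΠR.fold-map-cong _ _ (allFin m) (λ i → ≈-trans (≈-sym (^-+ (y i) (𝟙 (isKey b i)) (count i bs)))
                                                   (≈-reflexive (cong (y i ^_) (sym (count-∷ (λ b → isKey b i) b bs))))) ⟩
    Π (map (λ i → y i ^ count i (b ∷ bs)) (allFin m)) ∎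
    where
    isKey : _ → Fin m → Bool
    isKey b i = toℕ (key b) ≡ᵇ toℕ i
    count : Fin m → List _ → ℕ
    count i bs = length (filterᵇ (λ b → isKey b i) bs)
    key-only : Π (map (λ i → y i ^ 𝟙 (isKey b i)) (allFin m)) ≈ y (key b)
    key-only = ≈-trans (ΠR.fold-map-single _ (allFin m) (key b) (Unique.allFin⁺ m) (∈-allFin (key b)) off) on
      where
      off : ∀ {i} → i ∈ allFin m → i ≢ key b → y i ^ 𝟙 (isKey b i) ≈ 1#
      off {i} _ i≢key with isKey b i in eq
      ... | true = ⊥-elim (i≢key (toℕ-injective (sym (≡ᵇ-true⁻ eq))))
      ... | false = ≈-refl
      on : y (key b) ^ 𝟙 (isKey b (key b)) ≈ y (key b)
      on rewrite ≡ᵇ-true⁺ {toℕ (key b)} refl = *-identityʳ _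

  sliceMonomial : ∀ {d} {n : Fin d → ℕ} → Vars R d n → Arr d n → C
  sliceMonomial {d} {n} x A = Π (map (λ ℓ → Π (map (λ i → x ℓ i ^ Bsum A ℓ (toℕ i)) (allFin (n ℓ)))) (allFin d))

  cornerMonomial≡sliceMonomial : ∀ {d} {n : Fin d → ℕ} (x : Vars R d n) (π : Arr d n) →
    Π (map (λ c → Π (map (λ ℓ → x ℓ (proj₁ c ℓ)) (allFin d))) (corners π)) ≈ sliceMonomial x (cornerArr π)
  cornerMonomial≡sliceMonomial {d} {n} x π =
    ≈-trans (ΠR.fold-map-swap (λ c ℓ → x ℓ (proj₁ c ℓ)) (corners π) (allFin d))
      (ΠR.fold-map-cong _ _ (allFin d) (λ ℓ → ≈-trans (Π-collect (x ℓ) (λ c → proj₁ c ℓ) (corners π))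
        (ΠR.fold-map-cong _ _ (allFin (n ℓ)) (λ i → ≈-reflexive (cong (x ℓ i ^_) (exponent ℓ (toℕ i)))))))
    where
    exponent : ∀ ℓ j → length (filterᵇ (λ c → toℕ (proj₁ c ℓ) ≡ᵇ j) (corners π)) ≡ Bsum (cornerArr π) ℓ j
    exponent ℓ j = trans (count-corners-in-slice π ℓ j)
      (trans (boxSum-cong d n _ _ (λ p _ → slice-cong p)) (sym (Bsum≡boxSum-slice (cornerArr π) ℓ j)))
      where
      slice-cong : ∀ p → slice ℓ j (cornersAt π) p ≡ slice ℓ j (entry (cornerArr π)) p
      slice-cong p with p ℓ ≡ᵇ j
      ... | true = sym (entry-cornerArr π p)
      ... | false = refl

  F≈Σ-sliceMonomial : ∀ {d} (ℓ₀ : Fin d) (n : Fin d → ℕ) (h : ℕ) (x : Vars R d n) →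
    F R d n h x ≈ Σ (map (sliceMonomial x) (PartitionsAsArrays.arrays ℓ₀ n h))
  F≈Σ-sliceMonomial {d} ℓ₀ n h x =
    ≈-trans (ΣR.fold-map-cong _ (sliceMonomial x ∘ cornerArr) partitions (cornerMonomial≡sliceMonomial x))
      (ΣR.fold-map-bijection cornerArr lastPassageArr partitions arrays
        (Unique-filterᵇ _ (Unique-allArr d n h)) (Unique-filterᵇ _ (Unique-allArr d n h))
        cornerArr∈arrays lastPassageArr∘cornerArr lastPassageArr∈partitions cornerArr∘lastPassageArr
        (sliceMonomial x))
    where
    open LastPassage ℓ₀ n using (lastPassageArr)
    open PartitionsAsArrays ℓ₀ n h

Increasing : List ℕ → Set
Increasing = AllPairs _<_

Increasing⇒Unique : ∀ {xs} → Increasing xs → Unique xs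
Increasing⇒Unique [] = []
Increasing⇒Unique (x< ∷ inc) = All.map (λ x<y x≡y → <-irrefl x≡y x<y) x< ∷ Increasing⇒Unique inc

countBelow : List ℕ → ℕ → ℕ
countBelow xs v = length (filterᵇ (_<ᵇ v) xs)

countBelow-0 : ∀ xs → countBelow xs 0 ≡ 0
countBelow-0 [] = refl
countBelow-0 (x ∷ xs) = countBelow-0 xs

countBelow-suc-∉ : ∀ xs v → v ∉ xs → countBelow xs (suc v) ≡ countBelow xs v
countBelow-suc-∉ [] v _ = refl
countBelow-suc-∉ (x ∷ xs) v v∉ with x <ᵇ suc v in e₁ | x <ᵇ v in e₂
... | true | true = cong suc (countBelow-suc-∉ xs v (v∉ ∘ there))
... | false | false = countBelow-suc-∉ xs v (v∉ ∘ there)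
... | true | false = ⊥-elim (v∉ (here (≤-antisym (<ᵇ-false⁻ {x} e₂) (ℕ.≤-pred (<ᵇ-true⁻ {x} e₁)))))
... | false | true = ⊥-elim (<⇒≱ (<ᵇ-true⁻ {x} e₂) (≤-trans (ℕ.n≤1+n v) (<ᵇ-false⁻ {x} e₁)))

countBelow-above : ∀ xs v → All (v <_) xs → countBelow xs v ≡ 0 × countBelow xs (suc v) ≡ 0
countBelow-above [] v _ = refl , refl
countBelow-above (x ∷ xs) v (v<x ∷ v<xs) rewrite <ᵇ-false⁺ {x} {v} (ℕ.<⇒≤ v<x) | <ᵇ-false⁺ {x} {suc v} v<x =
  countBelow-above xs v v<xs

countBelow-suc-∈ : ∀ xs v → Increasing xs → v ∈ xs → countBelow xs (suc v) ≡ suc (countBelow xs v)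
countBelow-suc-∈ (x ∷ xs) v (v< ∷ _) (here refl) rewrite <ᵇ-false⁺ {v} {v} ≤-refl | <ᵇ-true⁺ {v} {suc v} ≤-refl =
  cong suc (trans (proj₂ (countBelow-above xs v v<)) (sym (proj₁ (countBelow-above xs v v<))))
countBelow-suc-∈ (x ∷ xs) v (x< ∷ inc) (there v∈)
  rewrite <ᵇ-true⁺ {x} {v} (All.lookup x< v∈) | <ᵇ-true⁺ {x} {suc v} (≤-trans (All.lookup x< v∈) (ℕ.n≤1+n v)) =
  cong suc (countBelow-suc-∈ xs v inc v∈)

countBelow-≥ : ∀ xs m v → All (_< m) xs → m ≤ v → countBelow xs v ≡ length xs
countBelow-≥ [] m v _ _ = refl
countBelow-≥ (x ∷ xs) m v (x<m ∷ xs<m) m≤v rewrite <ᵇ-true⁺ {x} {v} (<-≤-trans x<m m≤v) =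
  cong suc (countBelow-≥ xs m v xs<m m≤v)

-- The index of v in xs, or length xs if v does not occur.
position : List ℕ → ℕ → ℕ
position [] v = 0
position (x ∷ xs) v = if x ≡ᵇ v then 0 else suc (position xs v)

position-∉ : ∀ xs v → v ∉ xs → position xs v ≡ length xs
position-∉ [] v _ = refl
position-∉ (x ∷ xs) v v∉ rewrite ≡ᵇ-false⁺ {x} {v} (v∉ ∘ here ∘ sym) = cong suc (position-∉ xs v (v∉ ∘ there))

position≡countBelow : ∀ xs v → Increasing xs → v ∈ xs → position xs v ≡ countBelow xs v
position≡countBelow (x ∷ xs) v (v< ∷ _) (here refl) rewrite ≡ᵇ-true⁺ {v} {v} refl | <ᵇ-false⁺ {v} {v} ≤-refl =
  sym (proj₁ (countBelow-above xs v v<))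
position≡countBelow (x ∷ xs) v (x< ∷ inc) (there v∈)
  rewrite ≡ᵇ-false⁺ {x} {v} (λ x≡v → <-irrefl x≡v (All.lookup x< v∈)) | <ᵇ-true⁺ {x} {v} (All.lookup x< v∈) =
  cong suc (position≡countBelow xs v inc v∈)

position-ix : ∀ xs j → Increasing xs → j < length xs → position xs (ix xs j) ≡ j
position-ix (x ∷ xs) zero _ _ rewrite ≡ᵇ-true⁺ {x} {x} refl = refl
position-ix (x ∷ xs) (suc j) (x< ∷ inc) (s≤s j<)
  rewrite ≡ᵇ-false⁺ {x} {ix xs j} (λ x≡ → <-irrefl x≡ (All.lookup x< (ix-∈ xs j j<))) = cong suc (position-ix xs j inc j<)

position<length : ∀ xs v → v ∈ xs → position xs v < length xs
position<length (x ∷ xs) v (here refl) rewrite ≡ᵇ-true⁺ {v} {v} refl = s≤s z≤n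
position<length (x ∷ xs) v (there v∈) with x ≡ᵇ v
... | true = s≤s z≤n
... | false = s≤s (position<length xs v v∈)

ix-injective : ∀ xs i j → Increasing xs → i < length xs → j < length xs → ix xs i ≡ ix xs j → i ≡ j
ix-injective xs i j inc i< j< ix≡ = trans (sym (position-ix xs i inc i<)) (trans (cong (position xs) ix≡) (position-ix xs j inc j<))

ixOr : List ℕ → ℕ → ℕ → ℕ
ixOr [] j default = default
ixOr (x ∷ xs) zero default = x
ixOr (x ∷ xs) (suc j) default = ixOr xs j default

ixOr≡ix : ∀ xs j default → j < length xs → ixOr xs j default ≡ ix xs j
ixOr≡ix (x ∷ xs) zero _ _ = refl
ixOr≡ix (x ∷ xs) (suc j) default (s≤s j<) = ixOr≡ix xs j default j<

ixOr-≥ : ∀ xs j default → length xs ≤ j → ixOr xs j default ≡ default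
ixOr-≥ [] j default _ = refl
ixOr-≥ (x ∷ xs) (suc j) default (s≤s len≤) = ixOr-≥ xs j default len≤

ixOr-position : ∀ xs v default → v ∈ xs → ixOr xs (position xs v) default ≡ v
ixOr-position (x ∷ xs) v default (here refl) rewrite ≡ᵇ-true⁺ {v} {v} refl = refl
ixOr-position (x ∷ xs) v default (there v∈) with x ≡ᵇ v in e
... | true = ≡ᵇ-true⁻ e
... | false = ixOr-position xs v default v∈

ix-position : ∀ xs v → v ∈ xs → ix xs (position xs v) ≡ v
ix-position xs v v∈ = trans (sym (ixOr≡ix xs (position xs v) 0 (position<length xs v v∈))) (ixOr-position xs v 0 v∈)

Increasing-length≤ : ∀ xs m → Increasing xs → All (_< m) xs → length xs ≤ m
Increasing-length≤ xs m inc xs<m = go xs 0 inc xs<m (All.tabulate (λ _ → z≤n))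
  where
  go : ∀ xs s → Increasing xs → All (_< m) xs → All (s ≤_) xs → length xs ≤ m ∸ s
  go [] s _ _ _ = z≤n
  go (x ∷ xs) s (x< ∷ inc) (x<m ∷ xs<m) (s≤x ∷ _) = ≤-trans (s≤s (go xs (suc x) inc xs<m x<)) (ℕ.∸-monoʳ-< (s≤s s≤x) x<m)

Increasing-ext : ∀ xs ys → Increasing xs → Increasing ys → (∀ {z} → z ∈ xs → z ∈ ys) → (∀ {z} → z ∈ ys → z ∈ xs) → xs ≡ ys
Increasing-ext [] [] _ _ _ _ = refl
Increasing-ext [] (y ∷ ys) _ _ _ ys⊆ with () ← ys⊆ (here refl)
Increasing-ext (x ∷ xs) [] _ _ xs⊆ _ with () ← xs⊆ (here refl)
Increasing-ext (x ∷ xs) (y ∷ ys) (x< ∷ incx) (y< ∷ incy) xs⊆ ys⊆ with xs⊆ (here refl) | ys⊆ (here refl)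
... | there x∈ys | there y∈xs = ⊥-elim (<-irrefl refl (<-trans (All.lookup y< x∈ys) (All.lookup x< y∈xs)))
... | here refl | _ = cong (x ∷_) (Increasing-ext xs ys incx incy (tail x< xs⊆) (tail y< ys⊆))
  where
  tail : ∀ {w ws vs} → All (w <_) ws → (∀ {z} → z ∈ w ∷ ws → z ∈ w ∷ vs) → ∀ {z} → z ∈ ws → z ∈ vs
  tail w< ⊆ z∈ with ⊆ (there z∈)
  ... | here refl = ⊥-elim (<-irrefl refl (All.lookup w< z∈))
  ... | there z∈′ = z∈′
... | there x∈ys | here refl = ⊥-elim (<-irrefl refl (All.lookup y< x∈ys))

ix-≥ : ∀ c j → length c ≤ j → ix c j ≡ 0
ix-≥ [] j _ = refl
ix-≥ (x ∷ c) (suc j) (s≤s len≤) = ix-≥ c j len≤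

ix-stripZeros : ∀ s j → ix (stripZeros s) j ≡ ix s j
ix-stripZeros [] j = refl
ix-stripZeros (x ∷ s) j = trans (ix-cons0 x (stripZeros s) j) (ix-∷ j)
  where
  ix-cons0 : ∀ x ys j → ix (cons0 x ys) j ≡ ix (x ∷ ys) j
  ix-cons0 zero [] zero = refl
  ix-cons0 zero [] (suc j) = refl
  ix-cons0 zero (y ∷ ys) j = refl
  ix-cons0 (suc x) ys j = refl
  ix-∷ : ∀ j → ix (x ∷ stripZeros s) j ≡ ix (x ∷ s) j
  ix-∷ zero = refl
  ix-∷ (suc j) = ix-stripZeros s j

ix-≥-stripZeros : ∀ s j → length (stripZeros s) ≤ j → ix s j ≡ 0
ix-≥-stripZeros s j len≤ = trans (sym (ix-stripZeros s j)) (ix-≥ (stripZeros s) j len≤)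

LastPositive : List ℕ → Set
LastPositive ys = ∀ j → suc j ≡ length ys → 0 < ix ys j

stripZeros-lastPositive : ∀ s → LastPositive (stripZeros s)
stripZeros-lastPositive [] j ()
stripZeros-lastPositive (x ∷ s) = cons0-last x (stripZeros s) (stripZeros-lastPositive s)
  where
  cons0-last : ∀ x ys → LastPositive ys → LastPositive (cons0 x ys)
  cons0-last zero [] _ j ()
  cons0-last zero (y ∷ ys) _ zero ()
  cons0-last zero (y ∷ ys) last (suc j) e = last j (ℕ.suc-injective e)
  cons0-last (suc x) [] _ zero _ = s≤s z≤n
  cons0-last (suc x) [] _ (suc j) ()
  cons0-last (suc x) (y ∷ ys) _ zero ()
  cons0-last (suc x) (y ∷ ys) last (suc j) e = last j (ℕ.suc-injective e)

length-stripZeros : ∀ s k → (∀ j → j < k → 0 < ix s j) → (∀ j → k ≤ j → ix s j ≡ 0) → length (stripZeros s) ≡ k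
length-stripZeros s k pos zeros = ≤-antisym (ℕ.≮⇒≥ (λ k<len → too-long _ refl k<len)) (ℕ.≮⇒≥ (λ len<k → too-short k len<k pos))
  where
  too-short : ∀ k → length (stripZeros s) < k → (∀ j → j < k → 0 < ix s j) → ⊥
  too-short (suc k) len< pos = ℕ.<⇒≢ (subst (0 <_) (ix-≥-stripZeros s k (ℕ.≤-pred len<)) (pos k ≤-refl)) refl
  too-long : ∀ L → length (stripZeros s) ≡ L → k < L → ⊥
  too-long (suc L) len≡ k< =
    ℕ.<⇒≢ (subst (0 <_) (trans (ix-stripZeros s L) (zeros L (ℕ.≤-pred k<))) (stripZeros-lastPositive s L (sym len≡))) refl

allPositive : List ℕ → Bool
allPositive c = allᵇ (0 <ᵇ_) c

allPositive⁻ : ∀ c → allPositive c ≡ true → ∀ j → j < length c → 0 < ix c j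
allPositive⁻ (x ∷ c) e zero _ with 0 <ᵇ x in ex
... | true = <ᵇ-true⁻ {0} ex
allPositive⁻ (x ∷ c) e (suc j) (s≤s j<) with 0 <ᵇ x
... | true = allPositive⁻ c e j j<

allPositive⁺ : ∀ c → (∀ j → j < length c → 0 < ix c j) → allPositive c ≡ true
allPositive⁺ [] _ = refl
allPositive⁺ (x ∷ c) pos rewrite <ᵇ-true⁺ {0} {x} (pos 0 (s≤s z≤n)) = allPositive⁺ c (λ j j< → pos (suc j) (s≤s j<))

noGap-intro : ∀ v K → (∀ j → j < K → 0 < ix v j) → (∀ j → K ≤ j → ix v j ≡ 0) → noGap v ≡ true
noGap-intro v K pos zeros =
  allᵇ⁺ _ is (λ {i} _ → allᵇ⁺ _ is (λ {j} _ → allᵇ⁺ _ is (λ {k} _ →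
    no-gap (i <ᵇ j) (j <ᵇ k) (0 <ᵇ ix v i) (0 <ᵇ ix v k) (ix v j ≡ᵇ 0) (gap-free j k))))
  where
  is = upTo (length v)
  no-gap : ∀ a b c d e → (e ≡ false ⊎ (b ≡ true → d ≡ false)) → not (a ∧ b ∧ c ∧ d ∧ e) ≡ true
  no-gap a b c d false (inj₁ refl)
    rewrite Data.Bool.Properties.∧-zeroʳ d | Data.Bool.Properties.∧-zeroʳ c
          | Data.Bool.Properties.∧-zeroʳ b | Data.Bool.Properties.∧-zeroʳ a = refl
  no-gap a false c d e (inj₂ _) rewrite Data.Bool.Properties.∧-zeroʳ a = refl
  no-gap a true c d e (inj₂ b⇒¬d)
    rewrite b⇒¬d refl | Data.Bool.Properties.∧-zeroʳ c | Data.Bool.Properties.∧-zeroʳ a = refl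
  gap-free : ∀ j k → ((ix v j ≡ᵇ 0) ≡ false) ⊎ ((j <ᵇ k) ≡ true → (0 <ᵇ ix v k) ≡ false)
  gap-free j k with j <? K
  ... | yes j<K = inj₁ (≡ᵇ-false⁺ (λ e → ℕ.<⇒≢ (pos j j<K) (sym e)))
  ... | no j≮K = inj₂ (λ j<k → <ᵇ-false⁺ {0} {ix v k}
          (≤-reflexive (zeros k (≤-trans (ℕ.≮⇒≥ j≮K) (ℕ.<⇒≤ (<ᵇ-true⁻ {j} {k} j<k))))))

strictlyIncreasing⇒Increasing : ∀ {m} (is : List (Fin m)) → strictlyIncreasing is ≡ true → Increasing (map toℕ is)
strictlyIncreasing⇒Increasing [] _ = []
strictlyIncreasing⇒Increasing (i ∷ []) _ = [] ∷ []
strictlyIncreasing⇒Increasing (i ∷ j ∷ r) e =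
  extend (<ᵇ-true⁻ {toℕ i} (proj₁ (∧-true⁻ e))) (strictlyIncreasing⇒Increasing (j ∷ r) (proj₂ (∧-true⁻ e)))
  where
  extend : toℕ i < toℕ j → Increasing (map toℕ (j ∷ r)) → Increasing (map toℕ (i ∷ j ∷ r))
  extend i<j (j< ∷ inc) = (i<j ∷ All.map (<-trans i<j) j<) ∷ j< ∷ inc

Increasing⇒strictlyIncreasing : ∀ {m} (is : List (Fin m)) → Increasing (map toℕ is) → strictlyIncreasing is ≡ true
Increasing⇒strictlyIncreasing [] _ = refl
Increasing⇒strictlyIncreasing (i ∷ []) _ = refl
Increasing⇒strictlyIncreasing (i ∷ j ∷ r) ((i<j ∷ _) ∷ inc) rewrite <ᵇ-true⁺ {toℕ i} {toℕ j} i<j =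
  Increasing⇒strictlyIncreasing (j ∷ r) inc

Increasing-filter-allFin : ∀ m (q : Fin m → Bool) → Increasing (map toℕ (filterᵇ q (allFin m)))
Increasing-filter-allFin m q = AllPairs.map⁺ (AllPairs.filter⁺ (T? ∘ q) (AllPairs.tabulate⁺-< id))

-- A first-order encoding of families (ℓ : Fin d) → List (Fin (n ℓ)), so that families can be enumerated
-- and compared with _≡_.
Positions : (d : ℕ) → (Fin d → ℕ) → Set
Positions zero n = ⊤
Positions (suc d) n = List (Fin (n Fin.zero)) × Positions d (n ∘ Fin.suc)

at : ∀ {d} {n : Fin d → ℕ} → Positions d n → (ℓ : Fin d) → List (Fin (n ℓ))
at {suc d} (is , t) Fin.zero = is
at {suc d} (is , t) (Fin.suc ℓ) = at t ℓ

tabulateP : ∀ {d} {n : Fin d → ℕ} → ((ℓ : Fin d) → List (Fin (n ℓ))) → Positions d n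
tabulateP {zero} f = tt
tabulateP {suc d} f = f Fin.zero , tabulateP (f ∘ Fin.suc)

at-tabulateP : ∀ {d} {n : Fin d → ℕ} (f : (ℓ : Fin d) → List (Fin (n ℓ))) ℓ → at {n = n} (tabulateP f) ℓ ≡ f ℓ
at-tabulateP {suc d} f Fin.zero = refl
at-tabulateP {suc d} {n} f (Fin.suc ℓ) = at-tabulateP {n = n ∘ Fin.suc} (f ∘ Fin.suc) ℓ

Positions-ext : ∀ {d} {n : Fin d → ℕ} (t t′ : Positions d n) → (∀ ℓ → at {n = n} t ℓ ≡ at t′ ℓ) → t ≡ t′
Positions-ext {zero} t t′ _ = refl
Positions-ext {suc d} {n} (is , t) (is′ , t′) at≡ = cong₂ _,_ (at≡ Fin.zero) (Positions-ext {n = n ∘ Fin.suc} t t′ (at≡ ∘ Fin.suc))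

allPositions : ∀ {d} {n : Fin d → ℕ} → ((ℓ : Fin d) → List (List (Fin (n ℓ)))) → List (Positions d n)
allPositions {zero} S = tt ∷ []
allPositions {suc d} {n} S = concatMap (λ is → map (is ,_) (allPositions {n = n ∘ Fin.suc} (S ∘ Fin.suc))) (S Fin.zero)

∈-allPositions⁺ : ∀ {d} {n : Fin d → ℕ} (S : (ℓ : Fin d) → List (List (Fin (n ℓ)))) (t : Positions d n) →
  (∀ ℓ → at t ℓ ∈ S ℓ) → t ∈ allPositions S
∈-allPositions⁺ {zero} S tt _ = here refl
∈-allPositions⁺ {suc d} {n} S (is , t) t∈ = ∈-concatMap⁺ (λ is → map (is ,_) rest) (go (t∈ Fin.zero))
  where
  rest = allPositions {n = n ∘ Fin.suc} (S ∘ Fin.suc)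
  go : ∀ {iss} → is ∈ iss → Any (λ is′ → (is , t) ∈ map (is′ ,_) rest) iss
  go (here refl) = here (∈-map⁺ (is ,_) (∈-allPositions⁺ {n = n ∘ Fin.suc} (S ∘ Fin.suc) t (t∈ ∘ Fin.suc)))
  go (there is∈) = there (go is∈)

∈-allPositions⁻ : ∀ {d} {n : Fin d → ℕ} (S : (ℓ : Fin d) → List (List (Fin (n ℓ)))) (t : Positions d n) →
  t ∈ allPositions S → ∀ ℓ → at t ℓ ∈ S ℓ
∈-allPositions⁻ {suc d} {n} S (is , t) t∈ = go (S Fin.zero) id (∈-concatMap⁻ (λ is → map (is ,_) rest) {xs = S Fin.zero} t∈)
  where
  rest = allPositions {n = n ∘ Fin.suc} (S ∘ Fin.suc)
  go : ∀ iss → (∀ {js} → js ∈ iss → js ∈ S Fin.zero) → Any (λ is′ → (is , t) ∈ map (is′ ,_) rest) iss →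
       ∀ ℓ → at {n = n} (is , t) ℓ ∈ S ℓ
  go (js ∷ iss) ⊆S (here t∈′) ℓ with ∈-map⁻ (js ,_) t∈′
  go (js ∷ iss) ⊆S (here t∈′) Fin.zero | _ , _ , refl = ⊆S (here refl)
  go (js ∷ iss) ⊆S (here t∈′) (Fin.suc ℓ) | _ , t∈rest , refl = ∈-allPositions⁻ {n = n ∘ Fin.suc} (S ∘ Fin.suc) t t∈rest ℓ
  go (js ∷ iss) ⊆S (there t∈′) ℓ = go iss (⊆S ∘ there) t∈′ ℓ

Unique-allPositions : ∀ {d} {n : Fin d → ℕ} (S : (ℓ : Fin d) → List (List (Fin (n ℓ)))) → (∀ ℓ → Unique (S ℓ)) →
  Unique (allPositions S)
Unique-allPositions {zero} S _ = [] ∷ []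
Unique-allPositions {suc d} {n} S u = Unique-concatMap (λ is → map (is ,_) rest) (u Fin.zero)
  (λ is → Unique-map (is ,_) (Unique-allPositions {n = n ∘ Fin.suc} (S ∘ Fin.suc) (u ∘ Fin.suc)) (λ _ _ → ,-injectiveʳ))
  disjoint
  where
  rest = allPositions {n = n ∘ Fin.suc} (S ∘ Fin.suc)
  disjoint : ∀ {is js t} → t ∈ map (is ,_) rest → t ∈ map (js ,_) rest → is ≡ js
  disjoint t∈ t∈′ with ∈-map⁻ _ t∈ | ∈-map⁻ _ t∈′
  ... | _ , _ , refl | _ , _ , e = ,-injectiveˡ e

Supported⇒Bsum≡0 : ∀ {d} {n : Fin d → ℕ} (A : Arr d n) (k : Fin d → ℕ) → Supported (entry A) k →
  ∀ ℓ j → k ℓ ≤ j → Bsum A ℓ j ≡ 0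
Supported⇒Bsum≡0 {d} {n} A k A-sup ℓ j k≤j = trans (Bsum≡boxSum-slice A ℓ j) (boxSum-zero d n _ (λ p _ → off p))
  where
  off : ∀ p → slice ℓ j (entry A) p ≡ 0
  off p with p ℓ ≡ᵇ j in e
  ... | true = A-sup p ℓ (subst (k ℓ ≤_) (sym (≡ᵇ-true⁻ e)) k≤j)
  ... | false = refl

Bsum-≥ : ∀ {d} {n : Fin d → ℕ} (A : Arr d n) ℓ j → n ℓ ≤ j → Bsum A ℓ j ≡ 0
Bsum-≥ {n = n} A = Supported⇒Bsum≡0 A n (entry-outside A)

ix-sVec : ∀ {d} {n : Fin d → ℕ} (A : Arr d n) ℓ j → ix (sVec A ℓ) j ≡ Bsum A ℓ j
ix-sVec {n = n} A ℓ j rewrite map-applyUpTo id (Bsum A ℓ) (n ℓ) with j <? n ℓ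
... | yes j<n = ix-applyUpTo (Bsum A ℓ) (n ℓ) j j<n
  where
  ix-applyUpTo : ∀ (f : ℕ → ℕ) m j → j < m → ix (applyUpTo f m) j ≡ f j
  ix-applyUpTo f (suc m) zero _ = refl
  ix-applyUpTo f (suc m) (suc j) (s≤s j<) = ix-applyUpTo (f ∘ suc) m j j<
... | no j≮n = trans (ix-≥ (applyUpTo (Bsum A ℓ) (n ℓ)) j (subst (_≤ j) (sym (length-applyUpTo (Bsum A ℓ) (n ℓ))) (ℕ.≮⇒≥ j≮n)))
                     (sym (Bsum-≥ A ℓ j (ℕ.≮⇒≥ j≮n)))

entry≤Bsum : ∀ {d} {n : Fin d → ℕ} (A : Arr d n) q ℓ → InBox n q → entry A q ≤ Bsum A ℓ (q ℓ)
entry≤Bsum {d} {n} A q ℓ q∈ = subst₂ _≤_ on-slice (sym (Bsum≡boxSum-slice A ℓ (q ℓ)))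
  (≤-boxSum d n (slice ℓ (q ℓ) (entry A)) (slice-resp-≗ ℓ (q ℓ) (entry A) (entry-resp-≗ A)) q q∈)
  where
  on-slice : slice ℓ (q ℓ) (entry A) q ≡ entry A q
  on-slice rewrite ≡ᵇ-true⁺ {q ℓ} refl = refl

-- Deleting and reinserting zero slices

module Compression {d} (ℓ₀ : Fin d) (n : Fin d → ℕ) where
  open LastPassage ℓ₀ n

  posℕ : Positions d n → Fin d → List ℕ
  posℕ t ℓ = map toℕ (at t ℓ)

  width : Positions d n → Fin d → ℕ
  width t ℓ = length (posℕ t ℓ)

  IncreasingP : Positions d n → Set
  IncreasingP t = ∀ ℓ → Increasing (posℕ t ℓ)

  posℕ-< : ∀ t ℓ → All (_< n ℓ) (posℕ t ℓ)
  posℕ-< t ℓ = go (at t ℓ)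
    where
    go : ∀ {m} (is : List (Fin m)) → All (_< m) (map toℕ is)
    go [] = []
    go (i ∷ is) = toℕ<n i ∷ go is

  width≤ : ∀ t → IncreasingP t → ∀ ℓ → width t ℓ ≤ n ℓ
  width≤ t inc ℓ = Increasing-length≤ (posℕ t ℓ) (n ℓ) (inc ℓ) (posℕ-< t ℓ)

  -- expand A t moves the ℓ-th slices of A to the positions posℕ t ℓ; the other slices become zero.
  expandAt : Arr d n → Positions d n → Point d → ℕ
  expandAt A t p = entry A (λ ℓ → position (posℕ t ℓ) (p ℓ))

  expand : Arr d n → Positions d n → Arr d n
  expand A t = tabulateArr (expandAt A t)

  entry-expand : ∀ A t p → InBox n p → entry (expand A t) p ≡ expandAt A t p
  entry-expand A t = entry-tabulateArr (expandAt A t) (λ p≗q → entry-resp-≗ A (λ ℓ → cong (position (posℕ t ℓ)) (p≗q ℓ)))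

  entry-expand-∉ : ∀ A t → Supported (entry A) (width t) → ∀ p ℓ → p ℓ ∉ posℕ t ℓ → entry (expand A t) p ≡ 0
  entry-expand-∉ A t A-sup p ℓ p∉ with inBox? n p
  ... | yes p∈ = trans (entry-expand A t p p∈) (A-sup _ ℓ (≤-reflexive (sym (position-∉ (posℕ t ℓ) (p ℓ) p∉))))
  ... | no p∉box = entry-¬InBox (expand A t) p p∉box

  compressPoint : Positions d n → Point d → Point d
  compressPoint t p ℓ = countBelow (posℕ t ℓ) (p ℓ)

  compressPoint-bump-∈ : ∀ t p ℓ → IncreasingP t → p ℓ ∈ posℕ t ℓ → compressPoint t (bump p ℓ) ≗ bump (compressPoint t p) ℓ
  compressPoint-bump-∈ t p ℓ inc p∈ ℓ′ with ℓ′ ≟F ℓ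
  ... | yes refl = countBelow-suc-∈ (posℕ t ℓ′) (p ℓ′) (inc ℓ′) p∈
  ... | no _ = refl

  compressPoint-bump-∉ : ∀ t p ℓ → p ℓ ∉ posℕ t ℓ → compressPoint t (bump p ℓ) ≗ compressPoint t p
  compressPoint-bump-∉ t p ℓ p∉ ℓ′ with ℓ′ ≟F ℓ
  ... | yes refl = countBelow-suc-∉ (posℕ t ℓ′) (p ℓ′) p∉
  ... | no _ = refl

  -- The last passage function of A read through compressPoint t satisfies the recursion that characterises the
  -- last passage function of expand A t: a step off the positions of t does not move the compressed point.
  G-expand : ∀ A t → IncreasingP t → Supported (entry A) (width t) → G (expand A t) ≡ G A
  G-expand A t inc A-sup =
    trans (G≡passage (expand A t) ℓ₀)
    (trans (sym (passage-unique ℓ₀ (entry (expand A t)) n (entry-outside (expand A t)) U U-out U-rec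
                                (pathBound n) origin (distToCorner-≤ n origin)))
    (trans (lastPassage-resp-≗ A (λ ℓ → countBelow-0 (posℕ t ℓ))) (sym (G≡passage A ℓ₀))))
    where
    U : Point d → ℕ
    U p = lastPassage A (compressPoint t p)
    U-out : ∀ p → ¬ InBox n p → U p ≡ 0
    U-out p p∉ with ¬InBox⇒outside n p p∉
    ... | ℓ , n≤p = passage-outside (entry A) (width t) A-sup (pathBound n) (compressPoint t p) ℓ
                      (≤-reflexive (sym (countBelow-≥ (posℕ t ℓ) (n ℓ) (p ℓ) (posℕ-< t ℓ) n≤p)))
    U-rec : ∀ p → InBox n p → U p ≡ entry (expand A t) p + maxDir (λ ℓ → U (bump p ℓ))
    U-rec p p∈ with all? (λ ℓ → p ℓ ∈ℕ? posℕ t ℓ)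
    ... | yes p∈t = trans (lastPassage-recursion A (compressPoint t p)) (cong₂ _+_
          (trans (entry-resp-≗ A (λ ℓ → sym (position≡countBelow (posℕ t ℓ) (p ℓ) (inc ℓ) (p∈t ℓ))))
                 (sym (entry-expand A t p p∈)))
          (maxDir-cong _ _ (λ ℓ → lastPassage-resp-≗ A (sym ∘ compressPoint-bump-∈ t p ℓ inc (p∈t ℓ)))))
    ... | no p∉t with ¬∀⟶∃¬ d _ (λ ℓ → p ℓ ∈ℕ? posℕ t ℓ) p∉t
    ... | ℓ₁ , p∉ = sym (trans (cong (_+ maxDir (λ ℓ → U (bump p ℓ))) (entry-expand-∉ A t A-sup p ℓ₁ p∉))
          (≤-antisym (maxDir-lub _ _ U-bump≤)
                     (≤-trans (≤-reflexive (lastPassage-resp-≗ A (sym ∘ compressPoint-bump-∉ t p ℓ₁ p∉)))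
                              (≤-maxDir (λ ℓ → U (bump p ℓ)) ℓ₁))))
      where
      U-bump≤ : ∀ ℓ → U (bump p ℓ) ≤ U p
      U-bump≤ ℓ with p ℓ ∈ℕ? posℕ t ℓ
      ... | yes p∈′ = ≤-trans (≤-reflexive (lastPassage-resp-≗ A (compressPoint-bump-∈ t p ℓ inc p∈′)))
                              (lastPassage-antitone A (compressPoint t p) ℓ)
      ... | no p∉′ = ≤-reflexive (lastPassage-resp-≗ A (compressPoint-bump-∉ t p ℓ p∉′))

  Bsum-expand-∉ : ∀ A t → Supported (entry A) (width t) → ∀ ℓ v → v ∉ posℕ t ℓ → Bsum (expand A t) ℓ v ≡ 0
  Bsum-expand-∉ A t A-sup ℓ v v∉ = trans (Bsum≡boxSum-slice (expand A t) ℓ v) (boxSum-zero d n _ (λ p _ → off p))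
    where
    off : ∀ p → slice ℓ v (entry (expand A t)) p ≡ 0
    off p with p ℓ ≡ᵇ v in e
    ... | true = entry-expand-∉ A t A-sup p ℓ (subst (_∉ posℕ t ℓ) (sym (≡ᵇ-true⁻ e)) v∉)
    ... | false = refl

  Bsum-expand-ix : ∀ A t → IncreasingP t → Supported (entry A) (width t) →
    ∀ ℓ j → j < width t ℓ → Bsum (expand A t) ℓ (ix (posℕ t ℓ) j) ≡ Bsum A ℓ j
  Bsum-expand-ix A t inc A-sup ℓ j j< = trans (Bsum≡boxSum-slice (expand A t) ℓ _) (trans
    (boxSum-reindex d n (posℕ t) (Increasing⇒Unique ∘ inc) (posℕ-< t) (width≤ t inc)
      (slice ℓ (ix (posℕ t ℓ) j) (entry (expand A t))) (slice ℓ j (entry A))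
      (slice-resp-≗ ℓ _ _ (entry-resp-≗ (expand A t))) (slice-resp-≗ ℓ _ _ (entry-resp-≗ A))
      (λ p ℓ′ p∉ → slice-zero (entry (expand A t)) p (entry-expand-∉ A t A-sup p ℓ′ p∉))
      (λ q ℓ′ q≥ → slice-zero (entry A) q (A-sup q ℓ′ q≥))
      on-positions)
    (sym (Bsum≡boxSum-slice A ℓ j)))
    where
    slice-zero : ∀ {i} (f : Point d → ℕ) p → f p ≡ 0 → slice ℓ i f p ≡ 0
    slice-zero {i} f p fp≡0 with p ℓ ≡ᵇ i
    ... | true = fp≡0
    ... | false = refl
    on-positions : ∀ q → (∀ ℓ′ → q ℓ′ < width t ℓ′) →
      slice ℓ (ix (posℕ t ℓ) j) (entry (expand A t)) (λ ℓ′ → ix (posℕ t ℓ′) (q ℓ′)) ≡ slice ℓ j (entry A) q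
    on-positions q q< rewrite Bool-ext {ix (posℕ t ℓ) (q ℓ) ≡ᵇ ix (posℕ t ℓ) j} {q ℓ ≡ᵇ j}
        (λ e → ≡ᵇ-true⁺ (ix-injective (posℕ t ℓ) (q ℓ) j (inc ℓ) (q< ℓ) j< (≡ᵇ-true⁻ e)))
        (λ e → ≡ᵇ-true⁺ (cong (ix (posℕ t ℓ)) (≡ᵇ-true⁻ e)))
      with q ℓ ≡ᵇ j
    ... | false = refl
    ... | true = trans (entry-expand A t _ (λ ℓ′ → All.lookup (posℕ-< t ℓ′) (ix-∈ (posℕ t ℓ′) (q ℓ′) (q< ℓ′))))
                       (entry-resp-≗ A (λ ℓ′ → position-ix (posℕ t ℓ′) (q ℓ′) (inc ℓ′) (q< ℓ′)))

  -- Indices past the end of posℕ t ℓ are sent to n ℓ, outside the box.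
  compressAt : Arr d n → Positions d n → Point d → ℕ
  compressAt B t q = entry B (λ ℓ → ixOr (posℕ t ℓ) (q ℓ) (n ℓ))

  compressAt-supported : ∀ B t → Supported (compressAt B t) (width t)
  compressAt-supported B t q ℓ q≥ = entry-outside B _ ℓ (≤-reflexive (sym (ixOr-≥ (posℕ t ℓ) (q ℓ) (n ℓ) q≥)))

  compress : Arr d n → Positions d n → Arr d n
  compress B t = tabulateArr (compressAt B t)

  entry-compress : ∀ B t → IncreasingP t → ∀ q → entry (compress B t) q ≡ compressAt B t q
  entry-compress B t inc = entry-tabulateArr′ (compressAt B t)
    (λ p≗q → entry-resp-≗ B (λ ℓ → cong (λ z → ixOr (posℕ t ℓ) z (n ℓ)) (p≗q ℓ)))
    (λ q q∉ → let ℓ , n≤q = ¬InBox⇒outside n q q∉ in compressAt-supported B t q ℓ (≤-trans (width≤ t inc ℓ) n≤q))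

  compress-supported : ∀ B t → IncreasingP t → Supported (entry (compress B t)) (width t)
  compress-supported B t inc q ℓ q≥ = trans (entry-compress B t inc q) (compressAt-supported B t q ℓ q≥)

  expand∘compress : ∀ B t → IncreasingP t → (∀ p ℓ → InBox n p → p ℓ ∉ posℕ t ℓ → entry B p ≡ 0) →
    expand (compress B t) t ≡ B
  expand∘compress B t inc B-off = Arr-ext (expand (compress B t) t) B (λ p p∈ →
    trans (entry-expand (compress B t) t p p∈) (trans (entry-compress B t inc _) (back p p∈)))
    where
    back : ∀ p → InBox n p → compressAt B t (λ ℓ → position (posℕ t ℓ) (p ℓ)) ≡ entry B p
    back p p∈ with all? (λ ℓ → p ℓ ∈ℕ? posℕ t ℓ)
    ... | yes p∈t = entry-resp-≗ B (λ ℓ → ixOr-position (posℕ t ℓ) (p ℓ) (n ℓ) (p∈t ℓ))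
    ... | no p∉t with ¬∀⟶∃¬ d _ (λ ℓ → p ℓ ∈ℕ? posℕ t ℓ) p∉t
    ... | ℓ₁ , p∉ = trans (entry-outside B _ ℓ₁ (≤-reflexive (sym (ixOr-≥ (posℕ t ℓ₁) _ (n ℓ₁)
                            (≤-reflexive (sym (position-∉ (posℕ t ℓ₁) (p ℓ₁) p∉)))))))
                          (sym (B-off p ℓ₁ p∈ p∉))

  compress∘expand : ∀ A t → IncreasingP t → Supported (entry A) (width t) → compress (expand A t) t ≡ A
  compress∘expand A t inc A-sup = Arr-ext (compress (expand A t) t) A (λ q _ →
    trans (entry-compress (expand A t) t inc q) (back q))
    where
    back : ∀ q → compressAt (expand A t) t q ≡ entry A q
    back q with inBox? (width t) q
    ... | yes q< =
      trans (entry-resp-≗ (expand A t) {q = λ ℓ → ix (posℕ t ℓ) (q ℓ)} (λ ℓ → ixOr≡ix (posℕ t ℓ) (q ℓ) (n ℓ) (q< ℓ)))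
      (trans (entry-expand A t _ (λ ℓ → All.lookup (posℕ-< t ℓ) (ix-∈ (posℕ t ℓ) (q ℓ) (q< ℓ))))
             (entry-resp-≗ A (λ ℓ → position-ix (posℕ t ℓ) (q ℓ) (inc ℓ) (q< ℓ))))
    ... | no q≮ with ¬InBox⇒outside (width t) q q≮
    ... | ℓ₁ , q≥ = trans (entry-outside (expand A t) _ ℓ₁ (≤-reflexive (sym (ixOr-≥ (posℕ t ℓ₁) (q ℓ₁) (n ℓ₁) q≥))))
                          (sym (A-sup q ℓ₁ q≥))

  support : Arr d n → Positions d n
  support B = tabulateP (λ ℓ → filterᵇ (λ i → 0 <ᵇ Bsum B ℓ (toℕ i)) (allFin (n ℓ)))

  private
    posℕ-support : ∀ B ℓ → posℕ (support B) ℓ ≡ map toℕ (filterᵇ (λ i → 0 <ᵇ Bsum B ℓ (toℕ i)) (allFin (n ℓ)))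
    posℕ-support B ℓ = cong (map toℕ) (at-tabulateP {n = n} _ ℓ)

  support-increasing : ∀ B → IncreasingP (support B)
  support-increasing B ℓ = subst Increasing (sym (posℕ-support B ℓ)) (Increasing-filter-allFin (n ℓ) _)

  ∈-support⁻ : ∀ B ℓ v → v ∈ posℕ (support B) ℓ → 0 < Bsum B ℓ v
  ∈-support⁻ B ℓ v v∈ with ∈-map⁻ toℕ (subst (v ∈_) (posℕ-support B ℓ) v∈)
  ... | i , i∈ , refl = <ᵇ-true⁻ {0} (proj₂ (∈-filterᵇ⁻ _ {xs = allFin (n ℓ)} i∈))

  ∈-support⁺ : ∀ B ℓ v → v < n ℓ → 0 < Bsum B ℓ v → v ∈ posℕ (support B) ℓ
  ∈-support⁺ B ℓ v v<n 0<B = subst (v ∈_) (sym (posℕ-support B ℓ)) (subst (_∈ _) (toℕ-fromℕ< v<n)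
    (∈-map⁺ toℕ (∈-filterᵇ⁺ _ (∈-allFin (fromℕ< v<n))
      (<ᵇ-true⁺ (subst (λ z → 0 < Bsum B ℓ z) (sym (toℕ-fromℕ< v<n)) 0<B)))))

  support∘expand : ∀ A t → IncreasingP t → Supported (entry A) (width t) →
    (∀ ℓ j → j < width t ℓ → 0 < Bsum A ℓ j) → support (expand A t) ≡ t
  support∘expand A t inc A-sup A-pos = Positions-ext {n = n} (support (expand A t)) t (λ ℓ →
    map-injective toℕ-injective
      (Increasing-ext _ _ (support-increasing (expand A t) ℓ) (inc ℓ) (⊆t ℓ) (t⊆ ℓ)))
    where
    ⊆t : ∀ ℓ {z} → z ∈ posℕ (support (expand A t)) ℓ → z ∈ posℕ t ℓ
    ⊆t ℓ {z} z∈ with z ∈ℕ? posℕ t ℓ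
    ... | yes z∈t = z∈t
    ... | no z∉t = ⊥-elim (ℕ.<⇒≢ (∈-support⁻ (expand A t) ℓ z z∈) (sym (Bsum-expand-∉ A t A-sup ℓ z z∉t)))
    t⊆ : ∀ ℓ {z} → z ∈ posℕ t ℓ → z ∈ posℕ (support (expand A t)) ℓ
    t⊆ ℓ {z} z∈ = ∈-support⁺ (expand A t) ℓ z (All.lookup (posℕ-< t ℓ) z∈)
      (subst (λ w → 0 < Bsum (expand A t) ℓ w) (ix-position (posℕ t ℓ) z z∈)
        (subst (0 <_) (sym (Bsum-expand-ix A t inc A-sup ℓ _ j<)) (A-pos ℓ _ j<)))
      where
      j< = position<length (posℕ t ℓ) z z∈

Supported-Bsum : ∀ {d} {n : Fin d → ℕ} (A : Arr d n) (k : Fin d → ℕ) → (∀ ℓ j → k ℓ ≤ j → Bsum A ℓ j ≡ 0) →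
  Supported (entry A) k
Supported-Bsum {n = n} A k Bsum≡0 q ℓ k≤q with inBox? n q
... | yes q∈ = ℕ.n≤0⇒n≡0 (subst (entry A q ≤_) (Bsum≡0 ℓ (q ℓ) k≤q) (entry≤Bsum A q ℓ q∈))
... | no q∉ = entry-¬InBox A q q∉

-- Packed arrays together with the positions of their slices

module PackedDecomposition {d} (ℓ₀ : Fin d) (n : Fin d → ℕ) (h : ℕ) where
  open Compression ℓ₀ n
  open PartitionsAsArrays ℓ₀ n h using (arrays)

  composition : Arr d n → Fin d → List ℕ
  composition A ℓ = stripZeros (sVec A ℓ)

  parts : Arr d n → Fin d → ℕ
  parts A ℓ = length (composition A ℓ)

  -- The packed arrays of 𝓜 all of whose s_ℓ are compositions, i.e. have no leading zeros.
  isPackedM : Arr d n → Bool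
  isPackedM A = (G A ≤ᵇ h) ∧ packed A ∧ allᵇ (λ ℓ → allPositive (composition A ℓ)) (allFin d)

  module PackedFacts (A : Arr d n) (A-packed : isPackedM A ≡ true) where

    G≤h : G A ≤ h
    G≤h = ≤ᵇ-true⁻ (proj₁ (∧-true⁻ A-packed))

    Bsum-positive : ∀ ℓ j → j < parts A ℓ → 0 < Bsum A ℓ j
    Bsum-positive ℓ j j< = subst (0 <_) (trans (ix-stripZeros (sVec A ℓ) j) (ix-sVec A ℓ j))
      (allPositive⁻ (composition A ℓ) composition-positive j j<)
      where
      composition-positive : allPositive (composition A ℓ) ≡ true
      composition-positive = allᵇ⁻ (λ ℓ → allPositive (composition A ℓ)) (allFin d)
        (proj₂ (∧-true⁻ {packed A} (proj₂ (∧-true⁻ {G A ≤ᵇ h} A-packed)))) (∈-allFin ℓ)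

    supported : Supported (entry A) (parts A)
    supported = Supported-Bsum A (parts A) (λ ℓ j j≥ → trans (sym (ix-sVec A ℓ j)) (ix-≥-stripZeros (sVec A ℓ) j j≥))

  increasingWords : Arr d n → (ℓ : Fin d) → List (List (Fin (n ℓ)))
  increasingWords A ℓ = filterᵇ strictlyIncreasing (listsOver (parts A ℓ) (allFin (n ℓ)))

  packedArrays : List (Arr d n)
  packedArrays = filterᵇ isPackedM (allArr d n h)

  embeddings : List (Arr d n × Positions d n)
  embeddings = concatMap (λ A → map (A ,_) (allPositions (increasingWords A))) packedArrays

  ∈-embeddings⁻ : ∀ {A t} → (A , t) ∈ embeddings →
    A ∈ allArr d n h × isPackedM A ≡ true × (∀ ℓ → at t ℓ ∈ increasingWords A ℓ)
  ∈-embeddings⁻ {A} {t} At∈ = go packedArrays id (∈-concatMap⁻ (λ A → map (A ,_) (allPositions (increasingWords A))) At∈)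
    where
    go : ∀ As → (∀ {B} → B ∈ As → B ∈ packedArrays) → Any (λ B → (A , t) ∈ map (B ,_) (allPositions (increasingWords B))) As →
         A ∈ allArr d n h × isPackedM A ≡ true × (∀ ℓ → at t ℓ ∈ increasingWords A ℓ)
    go (B ∷ As) ⊆packed (here At∈′) with ∈-map⁻ (B ,_) At∈′
    ... | _ , t∈ , refl = let A∈ , A-packed = ∈-filterᵇ⁻ isPackedM {xs = allArr d n h} (⊆packed (here refl)) in
                          A∈ , A-packed , ∈-allPositions⁻ {n = n} (increasingWords A) t t∈
    go (B ∷ As) ⊆packed (there At∈′) = go As (⊆packed ∘ there) At∈′

  ∈-embeddings⁺ : ∀ {A t} → A ∈ allArr d n h → isPackedM A ≡ true → (∀ ℓ → at t ℓ ∈ increasingWords A ℓ) →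
    (A , t) ∈ embeddings
  ∈-embeddings⁺ {A} {t} A∈ A-packed t∈ =
    ∈-concatMap⁺ (λ A → map (A ,_) (allPositions (increasingWords A))) (go (∈-filterᵇ⁺ isPackedM A∈ A-packed))
    where
    go : ∀ {As} → A ∈ As → Any (λ B → (A , t) ∈ map (B ,_) (allPositions (increasingWords B))) As
    go (here refl) = here (∈-map⁺ (A ,_) (∈-allPositions⁺ {n = n} (increasingWords A) t t∈))
    go (there A∈′) = there (go A∈′)

  Unique-embeddings : Unique embeddings
  Unique-embeddings = Unique-concatMap (λ A → map (A ,_) (allPositions (increasingWords A)))
    (Unique-filterᵇ isPackedM (Unique-allArr d n h))
    (λ A → Unique-map (A ,_) (Unique-allPositions {n = n} (increasingWords A) (λ ℓ → Unique-filterᵇ strictlyIncreasing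
             (Unique-listsOver (allFin (n ℓ)) (parts A ℓ) (Unique.allFin⁺ (n ℓ))))) (λ _ _ → ,-injectiveʳ))
    disjoint
    where
    disjoint : ∀ {A B At} → At ∈ map (A ,_) (allPositions (increasingWords A)) →
               At ∈ map (B ,_) (allPositions (increasingWords B)) → A ≡ B
    disjoint At∈ At∈′ with ∈-map⁻ _ At∈ | ∈-map⁻ _ At∈′
    ... | _ , _ , refl | _ , _ , e = ,-injectiveˡ e

  width≡length-at : ∀ (t : Positions d n) ℓ → width t ℓ ≡ length (at t ℓ)
  width≡length-at t ℓ = length-map toℕ (at t ℓ)

  module EmbeddingFacts {A t} (At∈ : (A , t) ∈ embeddings) where
    A∈ = proj₁ (∈-embeddings⁻ At∈)
    A-packed = proj₁ (proj₂ (∈-embeddings⁻ At∈))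
    open PackedFacts A A-packed public

    private
      t∈ : ∀ ℓ → at t ℓ ∈ listsOver (parts A ℓ) (allFin (n ℓ)) × strictlyIncreasing (at t ℓ) ≡ true
      t∈ ℓ = ∈-filterᵇ⁻ strictlyIncreasing {xs = listsOver (parts A ℓ) (allFin (n ℓ))} (proj₂ (proj₂ (∈-embeddings⁻ At∈)) ℓ)

    width≡parts : ∀ ℓ → width t ℓ ≡ parts A ℓ
    width≡parts ℓ = trans (width≡length-at t ℓ) (proj₁ (∈-listsOver⁻ (allFin (n ℓ)) (parts A ℓ) (at t ℓ) (proj₁ (t∈ ℓ))))

    increasing : IncreasingP t
    increasing ℓ = strictlyIncreasing⇒Increasing (at t ℓ) (proj₂ (t∈ ℓ))

    supported-width : Supported (entry A) (width t)
    supported-width q ℓ q≥ = supported q ℓ (subst (_≤ q ℓ) (width≡parts ℓ) q≥)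

    Bsum-positive-width : ∀ ℓ j → j < width t ℓ → 0 < Bsum A ℓ j
    Bsum-positive-width ℓ j j< = Bsum-positive ℓ j (subst (j <_) (width≡parts ℓ) j<)

  expandPair : Arr d n × Positions d n → Arr d n
  expandPair (A , t) = expand A t

  decompose : Arr d n → Arr d n × Positions d n
  decompose B = compress B (support B) , support B

  expand∈arrays : ∀ {At} → At ∈ embeddings → expandPair At ∈ arrays
  expand∈arrays {A , t} At∈ = ∈-filterᵇ⁺ _ (∈-allArr⁺ h (expand A t) entry≤h)
      (≤ᵇ-true⁺ (subst (_≤ h) (sym (G-expand A t increasing supported-width)) G≤h))
    where
    open EmbeddingFacts At∈
    entry≤h : ∀ p → entry (expand A t) p ≤ h
    entry≤h p with inBox? n p
    ... | yes p∈ = subst (_≤ h) (sym (entry-expand A t p p∈)) (∈-allArr⁻ h A A∈ _)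
    ... | no p∉ = subst (_≤ h) (sym (entry-¬InBox (expand A t) p p∉)) z≤n

  decompose∘expand : ∀ {At} → At ∈ embeddings → decompose (expandPair At) ≡ At
  decompose∘expand {A , t} At∈ =
    cong₂ _,_ (trans (cong (compress (expand A t)) support≡) (compress∘expand A t increasing supported-width)) support≡
    where
    open EmbeddingFacts At∈
    support≡ : support (expand A t) ≡ t
    support≡ = support∘expand A t increasing supported-width Bsum-positive-width

  expand∘decompose : ∀ {B} → B ∈ arrays → expandPair (decompose B) ≡ B
  expand∘decompose {B} _ = expand∘compress B (support B) (support-increasing B) off
    where
    off : ∀ p ℓ → InBox n p → p ℓ ∉ posℕ (support B) ℓ → entry B p ≡ 0
    off p ℓ p∈ p∉ with 0 <? Bsum B ℓ (p ℓ)
    ... | yes 0< = ⊥-elim (p∉ (∈-support⁺ B ℓ (p ℓ) (p∈ ℓ) 0<))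
    ... | no 0≮ = ℕ.n≤0⇒n≡0 (≤-trans (entry≤Bsum B p ℓ p∈) (ℕ.≮⇒≥ 0≮))

  module DecomposeFacts {B} (B∈ : B ∈ arrays) where
    t = support B
    A = compress B t
    inc = support-increasing B
    A-sup = compress-supported B t inc

    Bsum-positive : ∀ ℓ j → j < width t ℓ → 0 < Bsum A ℓ j
    Bsum-positive ℓ j j< =
      subst (0 <_) (trans (cong (λ X → Bsum X ℓ (ix (posℕ t ℓ) j)) (sym (expand∘decompose B∈)))
                          (Bsum-expand-ix A t inc A-sup ℓ j j<))
        (∈-support⁻ B ℓ _ (ix-∈ (posℕ t ℓ) j j<))

    Bsum≡0 : ∀ ℓ j → width t ℓ ≤ j → Bsum A ℓ j ≡ 0
    Bsum≡0 = Supported⇒Bsum≡0 A (width t) A-sup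

    parts≡width : ∀ ℓ → parts A ℓ ≡ width t ℓ
    parts≡width ℓ = length-stripZeros (sVec A ℓ) (width t ℓ)
      (λ j j< → subst (0 <_) (sym (ix-sVec A ℓ j)) (Bsum-positive ℓ j j<))
      (λ j j≥ → trans (ix-sVec A ℓ j) (Bsum≡0 ℓ j j≥))

    A∈ : A ∈ allArr d n h
    A∈ = ∈-allArr⁺ h A (λ q → subst (_≤ h) (sym (entry-compress B t inc q))
                                    (∈-allArr⁻ h B (proj₁ (∈-filterᵇ⁻ _ {xs = allArr d n h} B∈)) _))

    A-packed : isPackedM A ≡ true
    A-packed = ∧-true⁺ (≤ᵇ-true⁺ G≤h) (∧-true⁺
      (allᵇ⁺ (λ ℓ → noGap (sVec A ℓ)) (allFin d) (λ {ℓ} _ → noGap-intro (sVec A ℓ) (width t ℓ)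
         (λ j j< → subst (0 <_) (sym (ix-sVec A ℓ j)) (Bsum-positive ℓ j j<))
         (λ j j≥ → trans (ix-sVec A ℓ j) (Bsum≡0 ℓ j j≥))))
      (allᵇ⁺ (λ ℓ → allPositive (composition A ℓ)) (allFin d) (λ {ℓ} _ → allPositive⁺ (composition A ℓ) (λ j j< →
         subst (0 <_) (sym (trans (ix-stripZeros (sVec A ℓ) j) (ix-sVec A ℓ j)))
               (Bsum-positive ℓ j (subst (j <_) (parts≡width ℓ) j<))))))
      where
      G≤h : G A ≤ h
      G≤h = subst (_≤ h) (trans (cong G (sym (expand∘decompose B∈))) (G-expand A t inc A-sup))
                         (≤ᵇ-true⁻ (proj₂ (∈-filterᵇ⁻ _ {xs = allArr d n h} B∈)))

  decompose∈embeddings : ∀ {B} → B ∈ arrays → decompose B ∈ embeddings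
  decompose∈embeddings B∈ = ∈-embeddings⁺ A∈ A-packed (λ ℓ → ∈-filterᵇ⁺ _
      (subst (λ k → at t ℓ ∈ listsOver k (allFin (n ℓ))) (trans (sym (width≡length-at t ℓ)) (sym (parts≡width ℓ)))
        (∈-listsOver⁺ (allFin (n ℓ)) (at t ℓ) (All.tabulate (λ {i} _ → ∈-allFin i))))
      (Increasing⇒strictlyIncreasing (at t ℓ) (inc ℓ)))
    where open DecomposeFacts B∈

-- Counting compositions

𝟙-∧ : ∀ a b → 𝟙 (a ∧ b) ≡ 𝟙 a * 𝟙 b
𝟙-∧ true b = sym (ℕ.+-identityʳ _)
𝟙-∧ false b = refl

map-allFin-suc : ∀ {a} {A : Set a} {d} (F : Fin (suc d) → A) → map F (allFin (suc d)) ≡ F Fin.zero ∷ map (F ∘ Fin.suc) (allFin d)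
map-allFin-suc F = trans (map-tabulate id F) (cong (F Fin.zero ∷_) (sym (map-tabulate id (F ∘ Fin.suc))))

*-sum : ∀ {A : Set} c (f : A → ℕ) xs → c * sum (map f xs) ≡ sum (map (λ x → c * f x) xs)
*-sum c f [] = ℕ.*-zeroʳ c
*-sum c f (x ∷ xs) = trans (ℕ.*-distribˡ-+ c _ _) (cong (c * f x +_) (*-sum c f xs))

sum-*ʳ : ∀ {A : Set} c (f : A → ℕ) xs → sum (map f xs) * c ≡ sum (map (λ x → f x * c) xs)
sum-*ʳ c f [] = refl
sum-*ʳ c f (x ∷ xs) = trans (ℕ.*-distribʳ-+ c (f x) _) (cong (f x * c +_) (sum-*ʳ c f xs))

count-tuples : ∀ d (cs : List (List ℕ)) (q : Fin d → List ℕ → Bool) →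
  sum (map (λ α → 𝟙 (allᵇ (λ ℓ → q ℓ (α ℓ)) (allFin d))) (tuples d cs)) ≡ product (map (λ ℓ → sum (map (𝟙 ∘ q ℓ) cs)) (allFin d))
count-tuples zero cs q = refl
count-tuples (suc d) cs q = begin
  sum (map (λ α → 𝟙 (allᵇ (λ ℓ → q ℓ (α ℓ)) (allFin (suc d)))) (tuples (suc d) cs))
    ≡⟨ Σℕ.fold-map-concatMap _ (λ β → map (consT β) (tuples d cs)) cs ⟩
  sum (map (λ β → sum (map (λ α → 𝟙 (allᵇ (λ ℓ → q ℓ (α ℓ)) (allFin (suc d)))) (map (consT β) (tuples d cs)))) cs)
    ≡⟨ Σℕ.fold-map-cong _ _ cs (λ β → trans (Σℕ.fold-map-map _ (consT β) (tuples d cs)) (trans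
         (Σℕ.fold-map-cong _ _ (tuples d cs) (λ α →
           trans (cong (𝟙 ∘ foldr _∧_ true) (map-allFin-suc (λ ℓ → q ℓ (consT β α ℓ)))) (𝟙-∧ (q Fin.zero β) _)))
         (sym (*-sum (𝟙 (q Fin.zero β)) _ (tuples d cs))))) ⟩
  sum (map (λ β → 𝟙 (q Fin.zero β) * sum (map (λ α → 𝟙 (allᵇ (λ ℓ → q (Fin.suc ℓ) (α ℓ)) (allFin d))) (tuples d cs))) cs)
    ≡⟨ Σℕ.fold-map-cong _ _ cs (λ β → cong (𝟙 (q Fin.zero β) *_) (count-tuples d cs (q ∘ Fin.suc))) ⟩
  sum (map (λ β → 𝟙 (q Fin.zero β) * rest) cs)
    ≡⟨ trans (sym (sum-*ʳ rest (𝟙 ∘ q Fin.zero) cs)) (sym (cong product (map-allFin-suc (λ ℓ → sum (map (𝟙 ∘ q ℓ) cs))))) ⟩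
  product (map (λ ℓ → sum (map (𝟙 ∘ q ℓ) cs)) (allFin (suc d))) ∎
  where
  open ≡-Reasoning
  rest = product (map (λ ℓ → sum (map (𝟙 ∘ q (Fin.suc ℓ)) cs)) (allFin d))

sEq⇒≡ : ∀ {u v} → sEq u v ≡ true → u ≡ v
sEq⇒≡ {u} {v} e with ≡-dec ℕ._≟_ u v
... | yes u≡v = u≡v

sEq-refl : ∀ u → sEq u u ≡ true
sEq-refl u with ≡-dec ℕ._≟_ u u
... | yes _ = refl
... | no u≢u = ⊥-elim (u≢u refl)

count-sEq : ∀ (cs : List (List ℕ)) c → Unique cs →
  (c ∈ cs → sum (map (𝟙 ∘ sEq c) cs) ≡ 1) × (c ∉ cs → sum (map (𝟙 ∘ sEq c) cs) ≡ 0)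
count-sEq cs c u = (λ c∈ → trans (Σℕ.fold-map-single (𝟙 ∘ sEq c) cs c u c∈ (λ _ → off)) (cong 𝟙 (sEq-refl c)))
                 , (λ c∉ → Σℕ.fold-map-ε-∈ _ cs (λ y∈ → off (λ y≡c → c∉ (subst (_∈ cs) y≡c y∈))))
  where
  off : ∀ {y} → y ≢ c → 𝟙 (sEq c y) ≡ 0
  off {y} y≢c with sEq c y in e
  ... | true = ⊥-elim (y≢c (sym (sEq⇒≡ e)))
  ... | false = refl

≤-sum : ∀ (c : List ℕ) {e} → e ∈ c → e ≤ sum c
≤-sum c e∈ = subst (_ ≤_) (cong sum (map-id c)) (≤-sum-map id c e∈)

length≤sum : ∀ (c : List ℕ) → allPositive c ≡ true → length c ≤ sum c
length≤sum [] _ = z≤n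
length≤sum (x ∷ c) e with 0 <ᵇ x in ex
... | true = ℕ.+-mono-≤ (<ᵇ-true⁻ {0} ex) (length≤sum c e)

∈-compositions⁺ : ∀ c N → allPositive c ≡ true → sum c ≡ N → c ∈ compositions N
∈-compositions⁺ c N c-pos sum≡N = ∈-filter⁺ (λ α → sum α ℕ.≟ N)
  (∈-concatMap⁺ (λ k → listsOver k (map suc (upTo N)))
    (∈⇒Any (∈-upTo⁺ (s≤s (subst (length c ≤_) sum≡N (length≤sum c c-pos))))
           (∈-listsOver⁺ (map suc (upTo N)) c (All.tabulate part∈))))
  sum≡N
  where
  ∈⇒Any : ∀ {P : ℕ → Set} {k ks} → k ∈ ks → P k → Any P ks
  ∈⇒Any (here refl) Pk = here Pk
  ∈⇒Any (there k∈) Pk = there (∈⇒Any k∈ Pk)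
  part∈ : ∀ {e} → e ∈ c → e ∈ map suc (upTo N)
  part∈ {e} e∈ with allᵇ⁻ (0 <ᵇ_) c c-pos e∈
  part∈ {suc e} e∈ | _ = ∈-map⁺ suc (∈-upTo⁺ (subst (suc e ≤_) sum≡N (≤-sum c e∈)))

∈-compositions⁻ : ∀ c N → c ∈ compositions N → allPositive c ≡ true × sum c ≡ N
∈-compositions⁻ c N c∈ with ∈-filter⁻ (λ α → sum α ℕ.≟ N) {xs = concatMap (λ k → listsOver k (map suc (upTo N))) (upTo (suc N))} c∈
... | c∈′ , sum≡N = go (upTo (suc N)) (∈-concatMap⁻ (λ k → listsOver k (map suc (upTo N))) {xs = upTo (suc N)} c∈′) , sum≡N
  where
  go : ∀ ks → Any (λ k → c ∈ listsOver k (map suc (upTo N))) ks → allPositive c ≡ true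
  go (k ∷ ks) (here c∈k) = allᵇ⁺ (0 <ᵇ_) c (λ e∈ → positive (All.lookup (proj₂ (∈-listsOver⁻ (map suc (upTo N)) k c c∈k)) e∈))
    where
    positive : ∀ {e} → e ∈ map suc (upTo N) → (0 <ᵇ e) ≡ true
    positive e∈ with ∈-map⁻ suc e∈
    ... | _ , _ , refl = refl
  go (k ∷ ks) (there c∈ks) = go ks c∈ks

Unique-compositions : ∀ N → Unique (compositions N)
Unique-compositions N = Unique.filter⁺ (λ α → sum α ℕ.≟ N)
  (Unique-concatMap (λ k → listsOver k (map suc (upTo N))) (Unique.upTo⁺ (suc N))
    (λ k → Unique-listsOver (map suc (upTo N)) k (Unique-map suc (Unique.upTo⁺ N) (λ _ _ → ℕ.suc-injective)))
    (λ {k} {k′} {c} c∈ c∈′ → trans (sym (proj₁ (∈-listsOver⁻ _ k c c∈))) (proj₁ (∈-listsOver⁻ _ k′ c c∈′))))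

count-compositions : ∀ c N → sum (map (𝟙 ∘ sEq c) (compositions N)) ≡ 𝟙 (allPositive c ∧ (sum c ≡ᵇ N))
count-compositions c N with allPositive c in c-pos | sum c ≡ᵇ N in sum≡
... | true | true = proj₁ (count-sEq (compositions N) c (Unique-compositions N)) (∈-compositions⁺ c N c-pos (≡ᵇ-true⁻ sum≡))
... | true | false = proj₂ (count-sEq (compositions N) c (Unique-compositions N))
                      (λ c∈ → ≡false⇒¬T sum≡ (≡true⇒T (≡ᵇ-true⁺ (proj₂ (∈-compositions⁻ c N c∈)))))
... | false | _ = proj₂ (count-sEq (compositions N) c (Unique-compositions N))
                      (λ c∈ → ≡false⇒¬T c-pos (≡true⇒T (proj₁ (∈-compositions⁻ c N c∈))))

sum-stripZeros : ∀ s → sum (stripZeros s) ≡ sum s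
sum-stripZeros [] = refl
sum-stripZeros (x ∷ s) = trans (sum-cons0 x (stripZeros s)) (cong (x +_) (sum-stripZeros s))
  where
  sum-cons0 : ∀ x ys → sum (cons0 x ys) ≡ x + sum ys
  sum-cons0 zero [] = refl
  sum-cons0 zero (y ∷ ys) = refl
  sum-cons0 (suc x) ys = refl

product-𝟙 : ∀ {A : Set} (p : A → Bool) xs → product (map (𝟙 ∘ p) xs) ≡ 𝟙 (allᵇ p xs)
product-𝟙 p [] = refl
product-𝟙 p (x ∷ xs) = trans (cong (𝟙 (p x) *_) (product-𝟙 p xs)) (sym (𝟙-∧ (p x) _))

product-zero : ∀ {A : Set} (f : A → ℕ) xs {x} → x ∈ xs → f x ≡ 0 → product (map f xs) ≡ 0
product-zero f (y ∷ xs) (here refl) fx≡0 = cong (_* product (map f xs)) fx≡0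
product-zero f (y ∷ xs) (there x∈) fx≡0 = trans (cong (f y *_) (product-zero f xs x∈ fx≡0)) (ℕ.*-zeroʳ (f y))

sum-𝟙-∧ : ∀ {A : Set} b (f : A → Bool) xs → sum (map (λ x → 𝟙 (b ∧ f x)) xs) ≡ 𝟙 b * sum (map (𝟙 ∘ f) xs)
sum-𝟙-∧ true f xs = sym (ℕ.*-identityˡ _)
sum-𝟙-∧ false f xs = Σℕ.fold-map-ε _ xs (λ _ → refl)

module CountingPackedArrays {d} (ℓ₀ : Fin d) (n : Fin d → ℕ) (h : ℕ) where
  open PackedDecomposition ℓ₀ n h

  size : Arr d n → ℕ
  size A = boxSum d n (entry A)

  sum-composition≡size : ∀ (A : Arr d n) ℓ → sum (composition A ℓ) ≡ size A
  sum-composition≡size A ℓ = begin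
    sum (stripZeros (sVec A ℓ))                                    ≡⟨ sum-stripZeros (sVec A ℓ) ⟩
    sum (map (Bsum A ℓ) (upTo (n ℓ)))                              ≡⟨ Σℕ.fold-map-cong _ _ (upTo (n ℓ)) (Bsum≡boxSum-slice A ℓ) ⟩
    sum (map (λ j → boxSum d n (slice ℓ j (entry A))) (upTo (n ℓ))) ≡⟨ sum-map-boxSum d n (upTo (n ℓ)) (λ j → slice ℓ j (entry A)) ⟩
    boxSum d n (λ p → sum (map (λ j → slice ℓ j (entry A) p) (upTo (n ℓ))))
      ≡⟨ boxSum-cong d n _ _ (λ p p∈ → trans (Σℕ.fold-map-single (λ j → slice ℓ j (entry A) p) (upTo (n ℓ)) (p ℓ)
                                                  (Unique.upTo⁺ (n ℓ)) (∈-upTo⁺ (p∈ ℓ)) (λ _ → off p)) (on p)) ⟩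
    size A ∎
    where
    open ≡-Reasoning
    off : ∀ p {j} → j ≢ p ℓ → slice ℓ j (entry A) p ≡ 0
    off p j≢ rewrite ≡ᵇ-false⁺ {p ℓ} (j≢ ∘ sym) = refl
    on : ∀ p → slice ℓ (p ℓ) (entry A) p ≡ entry A p
    on p rewrite ≡ᵇ-true⁺ {p ℓ} {p ℓ} refl = refl

  matches : (Fin d → List ℕ) → Arr d n → Bool
  matches α A = (G A ≤ᵇ h) ∧ packed A ∧ allᵇ (λ ℓ → sEq (stripZeros (sVec A ℓ)) (α ℓ)) (allFin d)

  count-matching-tuples : ∀ (A : Arr d n) N →
    sum (map (λ α → 𝟙 (allᵇ (λ ℓ → sEq (composition A ℓ) (α ℓ)) (allFin d))) (tuples d (compositions N)))
      ≡ 𝟙 (allᵇ (λ ℓ → allPositive (composition A ℓ)) (allFin d)) * 𝟙 (size A ≡ᵇ N)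
  count-matching-tuples A N = trans (count-tuples d (compositions N) (sEq ∘ composition A))
    (trans (cong product (map-cong (λ ℓ → trans (count-compositions (composition A ℓ) N)
             (trans (cong (λ s → 𝟙 (allPositive (composition A ℓ) ∧ (s ≡ᵇ N))) (sum-composition≡size A ℓ))
                    (𝟙-∧ (allPositive (composition A ℓ)) _))) (allFin d)))
    (factor (size A ≡ᵇ N)))
    where
    factor : ∀ b → product (map (λ ℓ → 𝟙 (allPositive (composition A ℓ)) * 𝟙 b) (allFin d))
                   ≡ 𝟙 (allᵇ (λ ℓ → allPositive (composition A ℓ)) (allFin d)) * 𝟙 b
    factor true = trans (cong product (map-cong (λ ℓ → ℕ.*-identityʳ _) (allFin d)))
      (trans (product-𝟙 (λ ℓ → allPositive (composition A ℓ)) (allFin d)) (sym (ℕ.*-identityʳ _)))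
    factor false = trans (product-zero _ (allFin d) (∈-allFin ℓ₀) (ℕ.*-zeroʳ (𝟙 (allPositive (composition A ℓ₀)))))
      (sym (ℕ.*-zeroʳ (𝟙 (allᵇ (λ ℓ → allPositive (composition A ℓ)) (allFin d)))))

  count-at-size : ∀ (A : Arr d n) N →
    sum (map (λ α → 𝟙 (matches α A)) (tuples d (compositions N))) ≡ 𝟙 (isPackedM A) * 𝟙 (size A ≡ᵇ N)
  count-at-size A N = begin
    sum (map (λ α → 𝟙 (matches α A)) αs)
      ≡⟨ sum-𝟙-∧ a _ αs ⟩
    𝟙 a * sum (map (λ α → 𝟙 (b ∧ _)) αs)
      ≡⟨ cong (𝟙 a *_) (sum-𝟙-∧ b _ αs) ⟩
    𝟙 a * (𝟙 b * sum (map (λ α → 𝟙 (allᵇ (λ ℓ → sEq (composition A ℓ) (α ℓ)) (allFin d))) αs))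
      ≡⟨ cong (λ z → 𝟙 a * (𝟙 b * z)) (count-matching-tuples A N) ⟩
    𝟙 a * (𝟙 b * (𝟙 ap * 𝟙 (size A ≡ᵇ N)))
      ≡⟨ cong (𝟙 a *_) (sym (ℕ.*-assoc (𝟙 b) _ _)) ⟩
    𝟙 a * (𝟙 b * 𝟙 ap * 𝟙 (size A ≡ᵇ N))
      ≡⟨ sym (ℕ.*-assoc (𝟙 a) _ _) ⟩
    𝟙 a * (𝟙 b * 𝟙 ap) * 𝟙 (size A ≡ᵇ N)
      ≡⟨ cong (_* 𝟙 (size A ≡ᵇ N)) (trans (cong (𝟙 a *_) (sym (𝟙-∧ b ap))) (sym (𝟙-∧ a (b ∧ ap)))) ⟩
    𝟙 (isPackedM A) * 𝟙 (size A ≡ᵇ N) ∎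
    where
    open ≡-Reasoning
    αs = tuples d (compositions N)
    a = G A ≤ᵇ h
    b = packed A
    ap = allᵇ (λ ℓ → allPositive (composition A ℓ)) (allFin d)

  count-over-sizes : ∀ (A : Arr d n) K → size A ≤ K →
    sum (map (λ N → sum (map (λ α → 𝟙 (matches α A)) (tuples d (compositions N)))) (upTo (suc K))) ≡ 𝟙 (isPackedM A)
  count-over-sizes A K size≤K = begin
    sum (map (λ N → sum (map (λ α → 𝟙 (matches α A)) (tuples d (compositions N)))) (upTo (suc K)))
      ≡⟨ Σℕ.fold-map-cong _ _ (upTo (suc K)) (count-at-size A) ⟩
    sum (map (λ N → 𝟙 (isPackedM A) * 𝟙 (size A ≡ᵇ N)) (upTo (suc K)))
      ≡⟨ sym (*-sum (𝟙 (isPackedM A)) (λ N → 𝟙 (size A ≡ᵇ N)) (upTo (suc K))) ⟩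
    𝟙 (isPackedM A) * sum (map (λ N → 𝟙 (size A ≡ᵇ N)) (upTo (suc K)))
      ≡⟨ cong (𝟙 (isPackedM A) *_) one-size ⟩
    𝟙 (isPackedM A) * 1
      ≡⟨ ℕ.*-identityʳ _ ⟩
    𝟙 (isPackedM A) ∎
    where
    open ≡-Reasoning
    one-size : sum (map (λ N → 𝟙 (size A ≡ᵇ N)) (upTo (suc K))) ≡ 1
    one-size = trans (Σℕ.fold-map-single (λ N → 𝟙 (size A ≡ᵇ N)) (upTo (suc K)) (size A) (Unique.upTo⁺ (suc K))
                                         (∈-upTo⁺ (s≤s size≤K)) (λ _ N≢ → cong 𝟙 (≡ᵇ-false⁺ (N≢ ∘ sym))))
                     (cong 𝟙 (≡ᵇ-true⁺ {size A} refl))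

module SemiringAlgebra {a l} (R : CommutativeSemiring a l) where
  open CommutativeSemiring R
    using (+-identityˡ; +-identityʳ; +-assoc; +-congˡ; +-congʳ; *-cong; zeroˡ; zeroʳ; distribˡ; distribʳ)
  open SemiringSums R
  open import Relation.Binary.Reasoning.Setoid setoid

  natMul-+ : ∀ i j y → natMul R (i + j) y ≈ natMul R i y +ᴿ natMul R j y
  natMul-+ zero j y = ≈-sym (+-identityˡ _)
  natMul-+ (suc i) j y = ≈-trans (+-congˡ (natMul-+ i j y)) (≈-sym (+-assoc _ _ _))

  natMul-𝟙 : ∀ b y → natMul R (𝟙 b) y ≈ (if b then y else 0#)
  natMul-𝟙 true y = +-identityʳ y
  natMul-𝟙 false y = ≈-refl

  natMul-count : ∀ {B : Set} (q : B → Bool) bs y → natMul R (length (filterᵇ q bs)) y ≈ Σ (map (λ b → natMul R (𝟙 (q b)) y) bs)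
  natMul-count q [] y = ≈-refl
  natMul-count q (b ∷ bs) y = ≈-trans (≈-reflexive (cong (λ k → natMul R k y) (count-∷ q b bs)))
    (≈-trans (natMul-+ (𝟙 (q b)) _ y) (+-congˡ (natMul-count q bs y)))

  Σ-natMul : ∀ {B : Set} (f : B → ℕ) bs y → Σ (map (λ b → natMul R (f b) y) bs) ≈ natMul R (sum (map f bs)) y
  Σ-natMul f [] y = ≈-refl
  Σ-natMul f (b ∷ bs) y = ≈-trans (+-congˡ (Σ-natMul f bs y)) (≈-sym (natMul-+ (f b) _ y))

  Σ-*ʳ : ∀ {B : Set} (f : B → C) bs c → Σ (map f bs) *ᴿ c ≈ Σ (map (λ b → f b *ᴿ c) bs)
  Σ-*ʳ f [] c = zeroˡ c
  Σ-*ʳ f (b ∷ bs) c = ≈-trans (distribʳ c _ _) (+-congˡ (Σ-*ʳ f bs c))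

  *-Σ : ∀ {B : Set} c (f : B → C) bs → c *ᴿ Σ (map f bs) ≈ Σ (map (λ b → c *ᴿ f b) bs)
  *-Σ c f [] = zeroʳ c
  *-Σ c f (b ∷ bs) = ≈-trans (distribˡ c _ _) (+-congˡ (*-Σ c f bs))

  Π-Σ-distrib : ∀ d {n : Fin d → ℕ} (S : (ℓ : Fin d) → List (List (Fin (n ℓ)))) (g : (ℓ : Fin d) → List (Fin (n ℓ)) → C) →
    Π (map (λ ℓ → Σ (map (g ℓ) (S ℓ))) (allFin d)) ≈ Σ (map (λ t → Π (map (λ ℓ → g ℓ (at {n = n} t ℓ)) (allFin d))) (allPositions S))
  Π-Σ-distrib zero S g = ≈-sym (+-identityʳ _)
  Π-Σ-distrib (suc d) {n} S g = begin
    Π (map (λ ℓ → Σ (map (g ℓ) (S ℓ))) (allFin (suc d)))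
      ≈⟨ ≈-reflexive (cong Π (map-allFin-suc (λ ℓ → Σ (map (g ℓ) (S ℓ))))) ⟩
    Σ (map (g Fin.zero) (S Fin.zero)) *ᴿ Π (map (λ ℓ → Σ (map (g (Fin.suc ℓ)) (S (Fin.suc ℓ)))) (allFin d))
      ≈⟨ *-cong ≈-refl (Π-Σ-distrib d {n ∘ Fin.suc} (S ∘ Fin.suc) (g ∘ Fin.suc)) ⟩
    Σ (map (g Fin.zero) (S Fin.zero)) *ᴿ Σ (map rest ts)
      ≈⟨ Σ-*ʳ (g Fin.zero) (S Fin.zero) _ ⟩
    Σ (map (λ is → g Fin.zero is *ᴿ Σ (map rest ts)) (S Fin.zero))
      ≈⟨ ΣR.fold-map-cong _ _ (S Fin.zero) (λ is → ≈-trans (*-Σ (g Fin.zero is) rest ts)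
           (≈-trans (ΣR.fold-map-cong _ _ ts (λ t → ≈-reflexive (sym (cong Π (map-allFin-suc (λ ℓ → g ℓ (at {n = n} (is , t) ℓ)))))))
                    (≈-sym (ΣR.fold-map-map whole (is ,_) ts)))) ⟩
    Σ (map (λ is → Σ (map whole (map (is ,_) ts))) (S Fin.zero))
      ≈⟨ ≈-sym (ΣR.fold-map-concatMap whole (λ is → map (is ,_) ts) (S Fin.zero)) ⟩
    Σ (map whole (allPositions S)) ∎
    where
    ts = allPositions {n = n ∘ Fin.suc} (S ∘ Fin.suc)
    rest : Positions d (n ∘ Fin.suc) → C
    rest t = Π (map (λ ℓ → g (Fin.suc ℓ) (at {n = n ∘ Fin.suc} t ℓ)) (allFin d))
    whole : Positions (suc d) n → C
    whole t = Π (map (λ ℓ → g ℓ (at {n = n} t ℓ)) (allFin (suc d)))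

  Π-zipWith-^ : ∀ {m} (y : Fin m → C) (e : ℕ → ℕ) (is : List (Fin m)) (es : List ℕ) → length is ≡ length es →
    (∀ j → j < length is → ix es j ≡ e (ix (map toℕ is) j)) →
    Π (zipWith (λ i k → y i ^ k) is es) ≈ Π (map (λ i → y i ^ e (toℕ i)) is)
  Π-zipWith-^ y e [] [] _ _ = ≈-refl
  Π-zipWith-^ y e (i ∷ is) (k ∷ es) len≡ es≡ = *-cong (≈-reflexive (cong (y i ^_) (es≡ 0 (s≤s z≤n))))
    (Π-zipWith-^ y e is es (ℕ.suc-injective len≡) (λ j j< → es≡ (suc j) (s≤s j<)))

-- The right-hand side

module RightHandSide {a l} (R : CommutativeSemiring a l) {d} (ℓ₀ : Fin d) (n : Fin d → ℕ) (h : ℕ) (x : Vars R d n) where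
  open CommutativeSemiring R using (+-congʳ)
  open SemiringSums R
  open SemiringAlgebra R
  open CornerMonomials R using (sliceMonomial)
  open Compression ℓ₀ n
  open PartitionsAsArrays ℓ₀ n h using (arrays)
  open PackedDecomposition ℓ₀ n h
  open CountingPackedArrays ℓ₀ n h
  open import Relation.Binary.Reasoning.Setoid setoid

  -- The term of M_{composition A ℓ}(x^{(ℓ)}) indexed by the increasing word is.
  wordMonomial : Arr d n → (ℓ : Fin d) → List (Fin (n ℓ)) → C
  wordMonomial A ℓ is = Π (zipWith (λ i e → x ℓ i ^ e) is (composition A ℓ))

  embeddingMonomial : Arr d n × Positions d n → C
  embeddingMonomial (A , t) = Π (map (λ ℓ → wordMonomial A ℓ (at t ℓ)) (allFin d))

  embeddingMonomial≈sliceMonomial : ∀ {At} → At ∈ embeddings → embeddingMonomial At ≈ sliceMonomial x (expandPair At)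
  embeddingMonomial≈sliceMonomial {A , t} At∈ = ΠR.fold-map-cong _ _ (allFin d) (λ ℓ → ≈-trans
      (Π-zipWith-^ (x ℓ) (Bsum (expand A t) ℓ) (at t ℓ) (composition A ℓ) (trans (sym (width≡length-at t ℓ)) (width≡parts ℓ))
        (λ j j< → trans (ix-stripZeros (sVec A ℓ) j) (trans (ix-sVec A ℓ j)
          (sym (Bsum-expand-ix A t increasing supported-width ℓ j (subst (j <_) (sym (width≡length-at t ℓ)) j<))))))
      (≈-sym (ΠR.fold-map-support _≟F_ _ (allFin (n ℓ)) (at t ℓ) (Unique.allFin⁺ (n ℓ))
                (Unique.map⁻ (Increasing⇒Unique (increasing ℓ))) (λ {i} _ → ∈-allFin i)
                (λ {i} _ i∉ → ≈-reflexive (cong (x ℓ i ^_) (Bsum-expand-∉ A t supported-width ℓ (toℕ i) (i∉ ∘ toℕ∈ ℓ i)))))))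
    where
    open EmbeddingFacts At∈
    toℕ∈ : ∀ ℓ i → toℕ i ∈ posℕ t ℓ → i ∈ at t ℓ
    toℕ∈ ℓ i i∈ with ∈-map⁻ toℕ i∈
    ... | j , j∈ , i≡j = subst (_∈ at t ℓ) (sym (toℕ-injective i≡j)) j∈

  Mproduct : (Fin d → List ℕ) → C
  Mproduct α = Π (map (λ ℓ → Mα R (α ℓ) (x ℓ)) (allFin d))

  -- No array with entries at most h has size above sizeBound.
  sizeBound : ℕ
  sizeBound = h * boxSum d n (λ _ → 1)

  private
    Mproduct-matches : ∀ α A → natMul R (𝟙 (matches α A)) (Mproduct α) ≈ natMul R (𝟙 (matches α A)) (Mproduct (composition A))
    Mproduct-matches α A with matches α A in e
    ... | false = ≈-refl
    ... | true = +-congʳ (ΠR.fold-map-cong _ _ (allFin d) (λ ℓ → ≈-reflexive (cong (λ c → Mα R c (x ℓ))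
          (sym (sEq⇒≡ {composition A ℓ} {α ℓ} (allᵇ⁻ (λ ℓ → sEq (composition A ℓ) (α ℓ)) (allFin d)
             (proj₂ (∧-true⁻ {packed A} (proj₂ (∧-true⁻ {G A ≤ᵇ h} e)))) (∈-allFin ℓ)))))))

  rhsUpTo≈Σ-packed : ∀ K → sizeBound ≤ K →
    rhsUpTo R d n h x K ≈ Σ (map (λ A → natMul R (𝟙 (isPackedM A)) (Mproduct (composition A))) (allArr d n h))
  rhsUpTo≈Σ-packed K bound≤K = begin
    Σ (map (rhsTerm R d n h x) Ns)
      ≈⟨ ΣR.fold-map-cong _ _ Ns (λ N → ΣR.fold-map-cong _ _ (tuples d (compositions N)) (λ α →
           ≈-trans (natMul-count (matches α) (allArr d n h) (Mproduct α))
                   (ΣR.fold-map-cong _ _ (allArr d n h) (Mproduct-matches α)))) ⟩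
    Σ (map (λ N → Σ (map (λ α → Σ (map (term α) (allArr d n h))) (αs N))) Ns)
      ≈⟨ ΣR.fold-map-cong _ _ Ns (λ N → ΣR.fold-map-swap term (αs N) (allArr d n h)) ⟩
    Σ (map (λ N → Σ (map (λ A → Σ (map (λ α → term α A) (αs N))) (allArr d n h))) Ns)
      ≈⟨ ΣR.fold-map-swap (λ N A → Σ (map (λ α → term α A) (αs N))) Ns (allArr d n h) ⟩
    Σ (map (λ A → Σ (map (λ N → Σ (map (λ α → term α A) (αs N))) Ns)) (allArr d n h))
      ≈⟨ ΣR.fold-map-cong-∈ _ _ (allArr d n h) collect ⟩
    Σ (map (λ A → natMul R (𝟙 (isPackedM A)) (Mproduct (composition A))) (allArr d n h)) ∎
    where
    Ns = upTo (suc K)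
    αs = λ N → tuples d (compositions N)
    term : (Fin d → List ℕ) → Arr d n → C
    term α A = natMul R (𝟙 (matches α A)) (Mproduct (composition A))
    collect : ∀ {A} → A ∈ allArr d n h →
      Σ (map (λ N → Σ (map (λ α → term α A) (αs N))) Ns) ≈ natMul R (𝟙 (isPackedM A)) (Mproduct (composition A))
    collect {A} A∈ = ≈-trans (ΣR.fold-map-cong _ _ Ns (λ N → Σ-natMul (λ α → 𝟙 (matches α A)) (αs N) _))
      (≈-trans (Σ-natMul (λ N → sum (map (λ α → 𝟙 (matches α A)) (αs N))) Ns _)
               (≈-reflexive (cong (λ k → natMul R k (Mproduct (composition A)))
                  (count-over-sizes A K (≤-trans (boxSum-≤ d n (entry A) h (∈-allArr⁻ h A A∈)) bound≤K)))))

  Σ-packed≈Σ-embeddings :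
    Σ (map (λ A → natMul R (𝟙 (isPackedM A)) (Mproduct (composition A))) (allArr d n h)) ≈ Σ (map embeddingMonomial embeddings)
  Σ-packed≈Σ-embeddings = begin
    Σ (map (λ A → natMul R (𝟙 (isPackedM A)) (Mproduct (composition A))) (allArr d n h))
      ≈⟨ ΣR.fold-map-cong _ _ (allArr d n h) (λ A → natMul-𝟙 (isPackedM A) _) ⟩
    Σ (map (λ A → if isPackedM A then Mproduct (composition A) else 0#) (allArr d n h))
      ≈⟨ ≈-sym (ΣR.fold-map-filterᵇ isPackedM (Mproduct ∘ composition) (allArr d n h)) ⟩
    Σ (map (Mproduct ∘ composition) packedArrays)
      ≈⟨ ΣR.fold-map-cong _ _ packedArrays (λ A → ≈-trans (Π-Σ-distrib d (increasingWords A) (wordMonomial A))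
           (≈-sym (ΣR.fold-map-map embeddingMonomial (A ,_) (allPositions (increasingWords A))))) ⟩
    Σ (map (λ A → Σ (map embeddingMonomial (map (A ,_) (allPositions (increasingWords A))))) packedArrays)
      ≈⟨ ≈-sym (ΣR.fold-map-concatMap embeddingMonomial (λ A → map (A ,_) (allPositions (increasingWords A))) packedArrays) ⟩
    Σ (map embeddingMonomial embeddings) ∎

  Σ-embeddings≈Σ-arrays : Σ (map embeddingMonomial embeddings) ≈ Σ (map (sliceMonomial x) arrays)
  Σ-embeddings≈Σ-arrays =
    ≈-trans (ΣR.fold-map-cong-∈ embeddingMonomial (sliceMonomial x ∘ expandPair) embeddings embeddingMonomial≈sliceMonomial)
      (ΣR.fold-map-bijection expandPair decompose embeddings arrays Unique-embeddings
        (Unique-filterᵇ _ (Unique-allArr d n h)) expand∈arrays decompose∘expand decompose∈embeddings expand∘decompose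
        (sliceMonomial x))

theorem6p12 : ∀ {a l} (R : CommutativeSemiring a l) (d : ℕ) → 1 ≤ d →
    (n : Fin d → ℕ) → (∀ ℓ → 0 < n ℓ) → (h : ℕ) → 0 < h →
    (x : Vars R d n) →
    ∃[ K₀ ] (∀ K → K₀ ≤ K →
      CommutativeSemiring._≈_ R (F R d n h x) (rhsUpTo R d n h x K))
theorem6p12 R (suc d) _ n _ h _ x = sizeBound , λ K sizeBound≤K → begin
  F R (suc d) n h x                                                    ≈⟨ F≈Σ-sliceMonomial ℓ₀ n h x ⟩
  Σ (map (sliceMonomial x) arrays)                                     ≈⟨ ≈-sym Σ-embeddings≈Σ-arrays ⟩
  Σ (map embeddingMonomial embeddings)                                 ≈⟨ ≈-sym Σ-packed≈Σ-embeddings ⟩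
  Σ (map (λ A → natMul R (𝟙 (isPackedM A)) (Mproduct (composition A))) (allArr (suc d) n h))
                                                                       ≈⟨ ≈-sym (rhsUpTo≈Σ-packed K sizeBound≤K) ⟩
  rhsUpTo R (suc d) n h x K                                            ∎
  where
  ℓ₀ = Fin.zero
  open SemiringSums R
  open CornerMonomials R using (sliceMonomial; F≈Σ-sliceMonomial)
  open PartitionsAsArrays ℓ₀ n h using (arrays)
  open PackedDecomposition ℓ₀ n h using (embeddings; isPackedM; composition)
  open RightHandSide R ℓ₀ n h x
  open import Relation.Binary.Reasoning.Setoid setoid
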